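{- Let $n\ge1$, $d\ge0$, let $\lambda$ be a partition with at most $n$ parts and $\beta\in\mathsf{B}_n$ with $|\lambda|+|\beta|=d$, and let $\alpha$ be a composition of $d$ with at most $n$ parts. If $\bm\lambda(\alpha)$ is not dominated by $\bm\lambda(\phi(\lambda,\beta))$, then $C^{\alpha}_{\lambda,\beta}=0$, where $C^\alpha_{\lambda,\beta}$ is the coefficient of $\mathcal{S}_\alpha$ in the expansion of $s_\lambda\,\mathcal{S}_\beta$ in the basis of quasisymmetric Schur polynomials.
   Context: $s_\lambda$ is the Schur polynomial in $x_1,\dots,x_n$. For a composition $\alpha$, $\bm\lambda(\alpha)$ is the partition obtained by sorting its parts decreasingly. A partition $\mu$ dominates $\nu$ if $\sum_{i=1}^k\mu_i\ge\sum_{i=1}^k\nu_i$ for all $k$. Quasisymmetric Schur polynomials: the diagram of $\alpha=(\alpha_1,\dots,\alpha_\ell)$ has $\alpha_i$ cells in row $i$ (rows from top), cell $(i,j)$. A composition tableau of shape $\alpha$ is a filling $T$ by positive integers with (CT1) rows weakly decreasing left to right; (CT2) first column strictly increasing top to bottom; (CT3) for cells $(i,k),(j,k)$ with $i<j$: if $\alpha_i\ge\alpha_j$ then $T(j,k)<T(i,k)$ or $T(i,k-1)<T(j,k)$ (with $T(i,0)$ read as $0$); if $\alpha_i<\alpha_j$ then $T(j,k)<T(i,k)$ or $T(i,k)<T(j,k+1)$. $\mathcal{S}_\alpha(x_1,\dots,x_n)=\sum_T\prod_i x_i^{\#\{\text{entries equal to }i\}}$ over composition tableaux of shape $\alpha$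 with entries in $\{1,\dots,n\}$; $\mathcal{S}_\emptyset=1$. The $\mathcal{S}_\alpha$ with $\ell(\alpha)\le n$ form a basis of the ring of quasisymmetric polynomials in $x_1,\dots,x_n$. $\mathsf{B}_n$: a composition $\alpha$ is inverting if for every $1<i\le\max_j\alpha_j$ there exist $s<t$ with $\alpha_s=i$, $\alpha_t=i-1$; writing uniquely $\alpha=\gamma\,k^{i_k}\cdots1^{i_1}$ ($i_j\ge1$, $\gamma$ avoiding the values $1,\dots,k$, $k$ maximal), $\alpha$ is pure if $k$ is even. $\mathsf{B}_n$ is the set of pure and inverting compositions with at most $n$ parts (including the empty one). The map $\phi$: for $\lambda=(\lambda_1\ge\dots\ge\lambda_L>0)$, if $L>\ell(\beta)$ append $L-\ell(\beta)$ zeros after the last part of $\beta$; order the parts of $\beta$ by size, where if $\beta_j=\beta_k$ with $j<k$ then $\beta_j$ counts as smaller; $\phi(\lambda,\beta)$ is obtained by adding $\lambda_i$ to the $i$-th largest part of $\beta$, $1\le i\le L$. -}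

module Defs where

open import Data.Bool using (Bool; true; false; _∧_; _∨_; not; T)
open import Data.Nat using (ℕ; zero; suc; _+_; _∸_; _≤_; _<_; _⊔_; _⊓_; _≤ᵇ_; _<ᵇ_; _≡ᵇ_)
open import Data.Nat.Divisibility using (_∣_)
open import Data.Nat.ListAction using (sum)
open import Data.Nat.Properties using (≤-decTotalOrder)
open import Data.List using (List; []; _∷_; map; length; concat; concatMap; upTo; filterᵇ;
  take; foldr; replicate; reverse; _++_; lookup)
open import Data.List.Sort ≤-decTotalOrder using (sort)
open import Data.List.Relation.Unary.All using (All)
open import Data.Vec using (Vec; []; _∷_; tabulate)
open import Data.Fin using (Fin; toℕ)
open import Data.Integer using (ℤ; +_) renaming (_+_ to _+ℤ_; _*_ to _*ℤ_)
open import Data.Product using (Σ; ∃; _×_; _,_)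
open import Relation.Binary.PropositionalEquality using (_≡_)

range1 : ℕ → List ℕ
range1 m = map suc (upTo m)

nth : List ℕ → ℕ → ℕ
nth []       _       = 0
nth (x ∷ xs) zero    = x
nth (x ∷ xs) (suc i) = nth xs i

nthRow : List (List ℕ) → ℕ → List ℕ
nthRow []       _       = []
nthRow (r ∷ rs) zero    = r
nthRow (r ∷ rs) (suc i) = nthRow rs i

maxPart : List ℕ → ℕ
maxPart = foldr _⊔_ 0

allᵇ : (ℕ → Bool) → List ℕ → Bool
allᵇ p = foldr (λ x b → p x ∧ b) true

_⇒ᵇ_ : Bool → Bool → Bool
a ⇒ᵇ b = not a ∨ b

data IsPartition : List ℕ → Set where
  []  : IsPartition []
  [_] : ∀ {x} → 0 < x → IsPartition (x ∷ [])
  _∷_ : ∀ {x y ys} → y ≤ x → IsPartition (y ∷ ys) → IsPartition (x ∷ y ∷ ys)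

IsComposition : List ℕ → Set
IsComposition α = All (λ x → 0 < x) α

-- λ(α): parts sorted decreasingly (zero parts, if any, removed)
sortDec : List ℕ → List ℕ
sortDec xs = reverse (sort (filterᵇ (λ x → 0 <ᵇ x) xs))

-- μ dominates ν  (partial sums; lists implicitly padded by zeros)
Dominates : List ℕ → List ℕ → Set
Dominates μ ν = ∀ k → sum (take k ν) ≤ sum (take k μ)

Inverting : List ℕ → Set
Inverting α = ∀ i → 1 < i → i ≤ maxPart α →
  Σ (Fin (length α)) λ s → Σ (Fin (length α)) λ t →
    (toℕ s < toℕ t) × (lookup α s ≡ i) × (lookup α t ≡ i ∸ 1)

-- Staircase k xs : xs = k^{i_k} (k-1)^{i_{k-1}} ... 1^{i_1} with all i_j ≥ 1
data Staircase : ℕ → List ℕ → Set where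
  base : Staircase 0 []
  step : ∀ {k xs} (a : ℕ) → Staircase k xs →
         Staircase (suc k) (replicate (suc a) (suc k) ++ xs)

Decomp : List ℕ → ℕ → Set
Decomp α k = Σ (List ℕ) λ γ → Σ (List ℕ) λ xs →
  All (λ x → k < x) γ × Staircase k xs × (α ≡ γ ++ xs)

Pure : List ℕ → Set
Pure α = Σ ℕ λ k → Decomp α k × (∀ k′ → Decomp α k′ → k′ ≤ k) × (2 ∣ k)

InB : ℕ → List ℕ → Set
InB n β = IsComposition β × length β ≤ n × Inverting β × Pure β

-- The part at
-- position j has rank r_j = #{k : b_k > b_j} + #{k > j : b_k = b_j}
-- (0-based), i.e. it is the (r_j+1)-th largest part; λ_{r_j+1} is added.
phi : List ℕ → List ℕ → List ℕ
phi lam β = map (λ j → nth b j + nth lam (rank j)) (upTo m)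
  where
  m : ℕ
  m = length lam ⊔ length β
  b : List ℕ
  b = β ++ replicate (length lam ∸ length β) 0
  rank : ℕ → ℕ
  rank j = length (filterᵇ (λ k → (nth b j <ᵇ nth b k) ∨ ((nth b j ≡ᵇ nth b k) ∧ (j <ᵇ k))) (upTo m))

-- Polynomials in x_1..x_n with integer coefficients,
-- represented by their coefficient function on exponent vectors.

Poly : ℕ → Set
Poly n = Vec ℕ n → ℤ

sumℤ : List ℤ → ℤ
sumℤ = foldr _+ℤ_ (+ 0)

below : ∀ {n} → Vec ℕ n → List (Vec ℕ n)
below []       = [] ∷ []
below (x ∷ xs) = concatMap (λ a → map (a ∷_) (below xs)) (upTo (suc x))

vsub : ∀ {n} → Vec ℕ n → Vec ℕ n → Vec ℕ n
vsub []       []       = []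
vsub (x ∷ xs) (y ∷ ys) = (x ∸ y) ∷ vsub xs ys

_⋆_ : ∀ {n} → Poly n → Poly n → Poly n
(f ⋆ g) e = sumℤ (map (λ a → f a *ℤ g (vsub e a)) (below e))

vecEqᵇ : ∀ {n} → Vec ℕ n → Vec ℕ n → Bool
vecEqᵇ []       []       = true
vecEqᵇ (x ∷ xs) (y ∷ ys) = (x ≡ᵇ y) ∧ vecEqᵇ xs ys

-- Fillings of diagrams: a filling is a list of rows (row i from the top),
-- entries in {1..n}.  Cell (i,k) is 1-indexed; entry T i 0 reads as 0.

words : ℕ → ℕ → List (List ℕ)
words n zero    = [] ∷ []
words n (suc m) = concatMap (λ x → map (x ∷_) (words n m)) (range1 n)

fillings : ℕ → List ℕ → List (List (List ℕ))
fillings n []       = [] ∷ []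
fillings n (r ∷ rs) = concatMap (λ w → map (w ∷_) (fillings n rs)) (words n r)

entry : List (List ℕ) → ℕ → ℕ → ℕ
entry T i zero    = 0
entry T i (suc k) = nth (nthRow T (i ∸ 1)) k

content : (n : ℕ) → List (List ℕ) → Vec ℕ n
content n T = tabulate (λ i → length (filterᵇ (λ x → x ≡ᵇ suc (toℕ i)) (concat T)))

isCT : List (List ℕ) → Bool
isCT T = ct1 ∧ ct2 ∧ ct3
  where
  ℓ = length T
  len : ℕ → ℕ
  len i = length (nthRow T (i ∸ 1))
  t = entry T
  ct1 = allᵇ (λ i → allᵇ (λ k → t i (suc k) ≤ᵇ t i k) (range1 (len i ∸ 1))) (range1 ℓ)
  ct2 = allᵇ (λ i → allᵇ (λ j → (i <ᵇ j) ⇒ᵇ (t i 1 <ᵇ t j 1)) (range1 ℓ)) (range1 ℓ)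
  ct3 = allᵇ (λ i → allᵇ (λ j → (i <ᵇ j) ⇒ᵇ
          allᵇ (λ k →
            ((len j ≤ᵇ len i) ⇒ᵇ ((t j k <ᵇ t i k) ∨ (t i (k ∸ 1) <ᵇ t j k))) ∧
            ((len i <ᵇ len j) ⇒ᵇ ((t j k <ᵇ t i k) ∨ (t i k <ᵇ t j (suc k)))))
            (range1 (len i ⊓ len j)))
          (range1 ℓ)) (range1 ℓ)

isSSYT : List (List ℕ) → Bool
isSSYT T = rowsOK ∧ colsOK
  where
  ℓ = length T
  len : ℕ → ℕ
  len i = length (nthRow T (i ∸ 1))
  t = entry T
  rowsOK = allᵇ (λ i → allᵇ (λ k → t i k ≤ᵇ t i (suc k)) (range1 (len i ∸ 1))) (range1 ℓ)
  colsOK = allᵇ (λ i → allᵇ (λ k → t i k <ᵇ t (suc i) k) (range1 (len (suc i)))) (range1 (ℓ ∸ 1))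

schur : (n : ℕ) → List ℕ → Poly n
schur n lam e = + length (filterᵇ (λ T → isSSYT T ∧ vecEqᵇ (content n T) e) (fillings n lam))

-- quasisymmetric Schur polynomial S_α(x_1..x_n)  (S_∅ = 1 automatically)
qsSchur : (n : ℕ) → List ℕ → Poly n
qsSchur n α e = + length (filterᵇ (λ T → isCT T ∧ vecEqᵇ (content n T) e) (fillings n α))

-- all compositions of d with at most n parts (each exactly once)
compositions : ℕ → ℕ → List (List ℕ)
compositions n d = filterᵇ (λ γ → sum γ ≡ᵇ d) (concatMap (words d) (upTo (suc n)))

-- c is the coefficient family of the expansion of p in the basis {S_γ},
-- restricted to the homogeneous degree d part (all S_γ with |γ| = d, ℓ(γ) ≤ n)
IsQSExpansion : (n d : ℕ) → Poly n → (List ℕ → ℤ) → Set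
IsQSExpansion n d p c =
  ∀ e → p e ≡ sumℤ (map (λ γ → c γ *ℤ qsSchur n γ e) (compositions n d))

module Submission where

-- If x^e occurs in s_λ S_β then e = a + b, where a is the content of a semistandard tableau of
-- shape λ and b that of a composition tableau of shape β. Both kinds of tableau have distinct
-- entries in each column, so any k of the variables together carry at most top_k λ + top_k β of
-- the exponents, top_k being the sum of the k largest parts; and top_k λ + top_k β ≤ top_k φ(λ,β),
-- since φ adds λ_i to the i-th largest part of β.
--
-- Suppose C^α ≠ 0 although λ(α) is not dominated by λ(φ). Among the compositions γ with C^γ ≠ 0
-- and top_k γ > top_k φ for some k, take g maximising Σ_k top_k γ and then Σ_v Σ_{u ≥ v} γ_u, and
-- compare the coefficients of x^g. On the left it is 0 by the bound above. On the right S_γ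
-- contributes only if some composition tableau of shape γ has content g, which forces top_k g ≤
-- top_k γ for all k and, once the lengths agree, Σ_{u ≥ v} g_u ≤ Σ_{u ≥ v} γ_u; maximality then
-- gives γ = g, and the superstandard tableau shows that x^g occurs in S_g. So the coefficient is
-- a positive multiple of C^g ≠ 0, a contradiction.

open import Data.Bool using (Bool; true; false; _∧_; _∨_; not; T)
open import Data.Bool.Properties using (∧-zeroʳ)
open import Data.Empty using (⊥; ⊥-elim)
open import Data.Fin using (toℕ)
open import Data.List
  using (List; []; _∷_; length; filter; filterᵇ; take; reverse; _++_; replicate; map; concat; concatMap; upTo; applyUpTo)
open import Data.List.Properties using (length-map; length-upTo; length-replicate; unfold-reverse)
open import Data.List.Extrema.Nat using (argmax; argmax-all; argmax-sel; f[xs]≤f[argmax])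
open import Data.List.Membership.Propositional using (_∈_; find)
open import Data.List.Membership.Propositional.Properties
  using (∈-filter⁺; ∈-filter⁻; ∈-map⁻; ∈-map⁺; ∈-concatMap⁻; ∈-concatMap⁺; ∈-upTo⁻; ∈-upTo⁺)
open import Data.List.Relation.Binary.Permutation.Propositional as ↭ using (_↭_)
open import Data.List.Relation.Binary.Permutation.Propositional.Properties using (↭-reverse)
open import Data.List.Relation.Unary.All as All using (All; []; _∷_)
open import Data.List.Relation.Unary.All.Properties using (all-filter; ∷ʳ⁺)
open import Data.List.Relation.Unary.AllPairs using (AllPairs; []; _∷_)
open import Data.List.Relation.Unary.Any as Any using (Any; here; there)
open import Data.List.Relation.Unary.Sorted.TotalOrder.Properties using (Sorted⇒AllPairs)
open import Data.Nat
open import Data.Nat.Properties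
open import Data.Nat.ListAction using (sum)
open import Data.Nat.ListAction.Properties using (sum-↭)
open import Data.List.Sort ≤-decTotalOrder using (sort-↭; sort-↗)
open import Data.Product using (Σ; ∃; _×_; _,_; proj₁; proj₂)
open import Data.Sum using (_⊎_; inj₁; inj₂)
open import Data.Vec using (Vec; []; _∷_; tabulate)
open import Data.Vec.Properties using (tabulate-cong)
open import Function using (_∘_; id; case_of_)
open import Relation.Binary.Definitions using (tri<; tri≈; tri>)
open import Relation.Binary.PropositionalEquality
open import Relation.Nullary using (¬_; yes; no; ¬?; T?)
open import Relation.Nullary.Decidable using (_×-dec_)
open import Relation.Unary using (Decidable)

open import Defs

𝟙 : Bool → ℕ
𝟙 true = 1
𝟙 false = 0

𝟙≤1 : ∀ b → 𝟙 b ≤ 1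
𝟙≤1 true = ≤-refl
𝟙≤1 false = z≤n

∑< : ℕ → (ℕ → ℕ) → ℕ
∑< zero f = 0
∑< (suc m) f = f 0 + ∑[ i < m ] f (suc i)

infixl 10 ∑<
syntax ∑< m (λ i → f) = ∑[ i < m ] f

∑<-cong : ∀ m {f g : ℕ → ℕ} → (∀ i → i < m → f i ≡ g i) → ∑< m f ≡ ∑< m g
∑<-cong zero h = refl
∑<-cong (suc m) h = cong₂ _+_ (h 0 z<s) (∑<-cong m (λ i i<m → h (suc i) (s<s i<m)))

∑<-mono-≤ : ∀ m {f g : ℕ → ℕ} → (∀ i → i < m → f i ≤ g i) → ∑< m f ≤ ∑< m g
∑<-mono-≤ zero h = z≤n
∑<-mono-≤ (suc m) h = +-mono-≤ (h 0 z<s) (∑<-mono-≤ m (λ i i<m → h (suc i) (s<s i<m)))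

∑<-mono-< : ∀ m {f g : ℕ → ℕ} → (∀ i → i < m → f i ≤ g i) → ∀ j → j < m → f j < g j → ∑< m f < ∑< m g
∑<-mono-< (suc m) h zero j<m lt = +-mono-<-≤ lt (∑<-mono-≤ m (λ i i<m → h (suc i) (s<s i<m)))
∑<-mono-< (suc m) h (suc j) (s<s j<m) lt = +-mono-≤-< (h 0 z<s) (∑<-mono-< m (λ i i<m → h (suc i) (s<s i<m)) j j<m lt)

∑<-distrib-+ : ∀ m (f g : ℕ → ℕ) → ∑[ i < m ] (f i + g i) ≡ ∑< m f + ∑< m g
∑<-distrib-+ zero f g = refl
∑<-distrib-+ (suc m) f g rewrite ∑<-distrib-+ m (λ i → f (suc i)) (λ i → g (suc i)) =
  +-comm-4 (f 0) (g 0) (∑[ i < m ] f (suc i)) (∑[ i < m ] g (suc i))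
  where
  +-comm-4 : ∀ a b c d → a + b + (c + d) ≡ a + c + (b + d)
  +-comm-4 a b c d = begin
    a + b + (c + d) ≡⟨ +-assoc a b (c + d) ⟩
    a + (b + (c + d)) ≡⟨ cong (a +_) (sym (+-assoc b c d)) ⟩
    a + (b + c + d) ≡⟨ cong (λ z → a + (z + d)) (+-comm b c) ⟩
    a + (c + b + d) ≡⟨ cong (a +_) (+-assoc c b d) ⟩
    a + (c + (b + d)) ≡⟨ sym (+-assoc a c (b + d)) ⟩
    a + c + (b + d) ∎
    where open ≡-Reasoning

∑<-zero : ∀ m {f : ℕ → ℕ} → (∀ i → i < m → f i ≡ 0) → ∑< m f ≡ 0
∑<-zero zero h = refl
∑<-zero (suc m) h rewrite h 0 z<s = ∑<-zero m (λ i i<m → h (suc i) (s<s i<m))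

∑<-comm : ∀ m M (f : ℕ → ℕ → ℕ) → ∑[ i < m ] (∑[ t < M ] f i t) ≡ ∑[ t < M ] (∑[ i < m ] f i t)
∑<-comm zero M f = sym (∑<-zero M (λ _ _ → refl))
∑<-comm (suc m) M f = begin
  ∑< M (f 0) + ∑[ i < m ] (∑[ t < M ] f (suc i) t) ≡⟨ cong (∑< M (f 0) +_) (∑<-comm m M (λ i → f (suc i))) ⟩
  ∑< M (f 0) + ∑[ t < M ] (∑[ i < m ] f (suc i) t) ≡⟨ sym (∑<-distrib-+ M (f 0) (λ t → ∑[ i < m ] f (suc i) t)) ⟩
  ∑[ t < M ] (f 0 t + ∑[ i < m ] f (suc i) t) ∎
  where open ≡-Reasoning

∑<-split : ∀ a b (f : ℕ → ℕ) → ∑< (a + b) f ≡ ∑< a f + ∑[ i < b ] f (a + i)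
∑<-split zero b f = refl
∑<-split (suc a) b f rewrite ∑<-split a b (λ i → f (suc i)) = sym (+-assoc (f 0) _ _)

∑<-extend : ∀ m m' {f : ℕ → ℕ} → m ≤ m' → (∀ i → m ≤ i → f i ≡ 0) → ∑< m' f ≡ ∑< m f
∑<-extend m m' {f} le h = begin
  ∑< m' f ≡⟨ cong (λ z → ∑< z f) (sym (m+[n∸m]≡n le)) ⟩
  ∑< (m + (m' ∸ m)) f ≡⟨ ∑<-split m (m' ∸ m) f ⟩
  ∑< m f + ∑[ i < (m' ∸ m) ] f (m + i) ≡⟨ cong (∑< m f +_) (∑<-zero (m' ∸ m) (λ i _ → h (m + i) (m≤m+n m i))) ⟩
  ∑< m f + 0 ≡⟨ +-identityʳ _ ⟩
  ∑< m f ∎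
  where open ≡-Reasoning

∑<-const : ∀ m c → ∑[ _ < m ] c ≡ m * c
∑<-const zero c = refl
∑<-const (suc m) c = cong (c +_) (∑<-const m c)

∑<-≤1 : ∀ m {f : ℕ → ℕ} → (∀ i → i < m → f i ≤ 1) → ∑< m f ≤ m
∑<-≤1 m {f} h = ≤-trans (∑<-mono-≤ m h) (≤-reflexive (trans (∑<-const m 1) (*-identityʳ m)))

∑<-below : ∀ m h → h ≤ m → ∑[ i < m ] 𝟙 (i <ᵇ h) ≡ h
∑<-below m zero _ = ∑<-zero m (λ i _ → refl)
∑<-below (suc m) (suc h) (s≤s h≤m) = cong suc (∑<-below m h h≤m)

∑<-≤-equal : ∀ m {f g : ℕ → ℕ} → (∀ i → i < m → f i ≤ g i) → ∑< m f ≡ ∑< m g → ∀ j → j < m → f j ≡ g j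
∑<-≤-equal m h e j j<m with m≤n⇒m<n∨m≡n (h j j<m)
... | inj₂ eq = eq
... | inj₁ lt = ⊥-elim (<-irrefl e (∑<-mono-< m h j j<m lt))

∑<-atMostOne : ∀ m (p : ℕ → Bool) → (∀ i j → i < m → j < m → T (p i) → T (p j) → i ≡ j) → ∑[ i < m ] 𝟙 (p i) ≤ 1
∑<-atMostOne zero p h = z≤n
∑<-atMostOne (suc m) p h with p 0 in eq
... | true = ≤-reflexive (cong suc (∑<-zero m (λ i i<m → later-false i i<m)))
  where
  later-false : ∀ i → i < m → 𝟙 (p (suc i)) ≡ 0
  later-false i i<m with p (suc i) in e2
  ... | false = refl
  ... | true with h 0 (suc i) z<s (s<s i<m) (subst T (sym eq) _) (subst T (sym e2) _)
  ... | ()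
... | false = ∑<-atMostOne m (λ i → p (suc i))
  (λ i j i<m j<m pi pj → suc-injective (h (suc i) (suc j) (s<s i<m) (s<s j<m) pi pj))

∑<-positive : ∀ m (f : ℕ → ℕ) → 0 < ∑< m f → Σ ℕ λ i → i < m × 0 < f i
∑<-positive (suc m) f pos with f 0 in e
... | suc _ = 0 , z<s , subst (0 <_) (sym e) z<s
... | zero with ∑<-positive m (λ i → f (suc i)) pos
... | i , i<m , p = suc i , s<s i<m , p

∑<-term : ∀ m (f : ℕ → ℕ) j → j < m → f j ≤ ∑< m f
∑<-term (suc m) f zero _ = m≤m+n (f 0) _
∑<-term (suc m) f (suc j) (s<s j<m) = ≤-trans (∑<-term m (λ i → f (suc i)) j j<m) (m≤n+m _ (f 0))

∑<-≡0⇒ : ∀ m (f : ℕ → ℕ) → ∑< m f ≡ 0 → ∀ j → j < m → f j ≡ 0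
∑<-≡0⇒ m f e j j<m = n≤0⇒n≡0 (≤-trans (∑<-term m f j j<m) (≤-reflexive e))

∑<-point : ∀ m x (h : ℕ → ℕ) → x < m → ∑[ r < m ] (𝟙 (x ≡ᵇ r) * h r) ≡ h x
∑<-point (suc m) zero h _ = trans (cong₂ _+_ (+-identityʳ (h 0)) (∑<-zero m (λ i _ → refl))) (+-identityʳ (h 0))
∑<-point (suc m) (suc x) h (s<s x<m) = ∑<-point m x (λ r → h (suc r)) x<m

∑<-fibres : ∀ ℓ V (g w : ℕ → ℕ) → (∀ i → i < ℓ → w i ≡ 0 ⊎ g i < V) →
  ∑< ℓ w ≡ ∑[ v < V ] (∑[ i < ℓ ] (𝟙 (g i ≡ᵇ v) * w i))
∑<-fibres ℓ V g w gV = begin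
  ∑< ℓ w ≡⟨ ∑<-cong ℓ (λ i i<ℓ → single-fibre i (gV i i<ℓ)) ⟩
  ∑[ i < ℓ ] (∑[ v < V ] (𝟙 (g i ≡ᵇ v) * w i)) ≡⟨ ∑<-comm ℓ V _ ⟩
  ∑[ v < V ] (∑[ i < ℓ ] (𝟙 (g i ≡ᵇ v) * w i)) ∎
  where
  open ≡-Reasoning
  single-fibre : ∀ i → w i ≡ 0 ⊎ g i < V → w i ≡ ∑[ v < V ] (𝟙 (g i ≡ᵇ v) * w i)
  single-fibre i (inj₂ lt) = sym (∑<-point V (g i) (λ _ → w i) lt)
  single-fibre i (inj₁ z) rewrite z = sym (∑<-zero V (λ v _ → *-zeroʳ (𝟙 (g i ≡ᵇ v))))

𝟙-∧ : ∀ a b → 𝟙 a * 𝟙 b ≡ 𝟙 (a ∧ b)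
𝟙-∧ true b = +-identityʳ (𝟙 b)
𝟙-∧ false b = refl

T∧₁ : ∀ {a b} → T (a ∧ b) → T a
T∧₁ {true} _ = _

T∧₂ : ∀ {a b} → T (a ∧ b) → T b
T∧₂ {true} t = t

T∧ : ∀ {a b} → T a → T b → T (a ∧ b)
T∧ {true} _ t = t

T∨ : ∀ {a b} → T (a ∨ b) → T a ⊎ T b
T∨ {true} t = inj₁ t
T∨ {false} t = inj₂ t

∨T₁ : ∀ {a b} → T a → T (a ∨ b)
∨T₁ {true} _ = _

∨T₂ : ∀ {a b} → T b → T (a ∨ b)
∨T₂ {true} _ = _
∨T₂ {false} t = t

𝟙-T : ∀ b → T b → 𝟙 b ≡ 1
𝟙-T true _ = refl

𝟙-¬T : ∀ b → ¬ T b → 𝟙 b ≡ 0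
𝟙-¬T true h = ⊥-elim (h _)
𝟙-¬T false _ = refl

∑<-count-injective : ∀ ℓ V (c q : ℕ → Bool) (g : ℕ → ℕ) →
  (∀ i → i < ℓ → T (c i) → g i < V) →
  (∀ i → i < ℓ → T (c i) → T (q (g i))) →
  (∀ i j → i < ℓ → j < ℓ → T (c i) → T (c j) → g i ≡ g j → i ≡ j) →
  ∑[ i < ℓ ] 𝟙 (c i) ≤ ∑[ v < V ] 𝟙 (q v)
∑<-count-injective ℓ V c q g gV gq inj = begin
  ∑[ i < ℓ ] 𝟙 (c i) ≡⟨ ∑<-fibres ℓ V g (λ i → 𝟙 (c i)) vanishes-or-in-range ⟩
  ∑[ v < V ] (∑[ i < ℓ ] (𝟙 (g i ≡ᵇ v) * 𝟙 (c i))) ≤⟨ ∑<-mono-≤ V fibre≤ ⟩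
  ∑[ v < V ] 𝟙 (q v) ∎
  where
  open ≤-Reasoning
  vanishes-or-in-range : ∀ i → i < ℓ → 𝟙 (c i) ≡ 0 ⊎ g i < V
  vanishes-or-in-range i i<ℓ with c i in e
  ... | false = inj₁ refl
  ... | true = inj₂ (gV i i<ℓ (subst T (sym e) _))
  fibre≤ : ∀ v → v < V → ∑[ i < ℓ ] (𝟙 (g i ≡ᵇ v) * 𝟙 (c i)) ≤ 𝟙 (q v)
  fibre≤ v _ with q v in eq
  ... | true = ≤-trans (≤-reflexive (∑<-cong ℓ (λ i _ → 𝟙-∧ (g i ≡ᵇ v) (c i))))
                 (∑<-atMostOne ℓ (λ i → (g i ≡ᵇ v) ∧ c i)
                   (λ i j i<ℓ j<ℓ ti tj → inj i j i<ℓ j<ℓ (T∧₂ ti) (T∧₂ tj)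
                      (trans (≡ᵇ⇒≡ _ _ (T∧₁ ti)) (sym (≡ᵇ⇒≡ _ _ (T∧₁ tj))))))
  ... | false = ≤-reflexive (∑<-zero ℓ (λ i i<ℓ → fibre-vanishes i i<ℓ))
    where
    fibre-vanishes : ∀ i → i < ℓ → 𝟙 (g i ≡ᵇ v) * 𝟙 (c i) ≡ 0
    fibre-vanishes i i<ℓ with g i ≡ᵇ v in e1 | c i in e2
    ... | false | _ = refl
    ... | true | false = refl
    ... | true | true with subst T (cong q (≡ᵇ⇒≡ _ _ (subst T (sym e1) _))) (gq i i<ℓ (subst T (sym e2) _))
    ... | t = ⊥-elim (subst T eq t)

countAbove : ℕ → ℕ → (ℕ → ℕ) → ℕ
countAbove m t f = ∑[ i < m ] 𝟙 (t <ᵇ f i)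

-- Layer-cake form of the sum of the k largest values among f 0, …, f (m-1), for M bounding
-- them (subsetSum≤layers, layers≤topRankedSum).
layers : ℕ → ℕ → ℕ → (ℕ → ℕ) → ℕ
layers m M k f = ∑[ t < M ] (k ⊓ countAbove m t f)

∑<-*-distribˡ : ∀ m c (f : ℕ → ℕ) → c * ∑< m f ≡ ∑[ i < m ] (c * f i)
∑<-*-distribˡ zero c f = *-zeroʳ c
∑<-*-distribˡ (suc m) c f = trans (*-distribˡ-+ c (f 0) _) (cong (c * f 0 +_) (∑<-*-distribˡ m c (λ i → f (suc i))))

𝟙-<ᵇ-≥ : ∀ t x → x ≤ t → 𝟙 (t <ᵇ x) ≡ 0
𝟙-<ᵇ-≥ t x x≤t with t <ᵇ x in e
... | false = refl
... | true = ⊥-elim (<⇒≱ (<ᵇ⇒< t x (subst T (sym e) _)) x≤t)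

countAbove-≡0 : ∀ m t f → (∀ i → i < m → f i ≤ t) → countAbove m t f ≡ 0
countAbove-≡0 m t f h = ∑<-zero m (λ i i<m → 𝟙-<ᵇ-≥ t (f i) (h i i<m))

layers-height : ∀ m M M' k f → M ≤ M' → (∀ i → i < m → f i ≤ M) → layers m M' k f ≡ layers m M k f
layers-height m M M' k f le h = ∑<-extend M M' le
  (λ t M≤t → trans (cong (k ⊓_) (countAbove-≡0 m t f (λ i i<m → ≤-trans (h i i<m) M≤t))) (⊓-zeroʳ k))

𝟙*𝟙≤ˡ : ∀ b c → 𝟙 b * 𝟙 c ≤ 𝟙 b
𝟙*𝟙≤ˡ true c = ≤-trans (≤-reflexive (+-identityʳ (𝟙 c))) (𝟙≤1 c)
𝟙*𝟙≤ˡ false c = z≤n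

𝟙*𝟙≤ʳ : ∀ b c → 𝟙 b * 𝟙 c ≤ 𝟙 c
𝟙*𝟙≤ʳ true c = ≤-reflexive (+-identityʳ (𝟙 c))
𝟙*𝟙≤ʳ false c = z≤n

subsetSum≤layers : ∀ m M k (p : ℕ → Bool) (f : ℕ → ℕ) → ∑[ i < m ] 𝟙 (p i) ≤ k → (∀ i → i < m → f i ≤ M) →
       ∑[ i < m ] (𝟙 (p i) * f i) ≤ layers m M k f
subsetSum≤layers m M k p f pk fM = begin
  ∑[ i < m ] (𝟙 (p i) * f i) ≡⟨ ∑<-cong m (λ i i<m → cong (𝟙 (p i) *_) (sym (∑<-below M (f i) (fM i i<m)))) ⟩
  ∑[ i < m ] (𝟙 (p i) * ∑[ t < M ] 𝟙 (t <ᵇ f i)) ≡⟨ ∑<-cong m (λ i _ → ∑<-*-distribˡ M (𝟙 (p i)) _) ⟩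
  ∑[ i < m ] (∑[ t < M ] (𝟙 (p i) * 𝟙 (t <ᵇ f i))) ≡⟨ ∑<-comm m M _ ⟩
  ∑[ t < M ] (∑[ i < m ] (𝟙 (p i) * 𝟙 (t <ᵇ f i))) ≤⟨ ∑<-mono-≤ M (λ t _ → ⊓-glb
        (≤-trans (∑<-mono-≤ m (λ i _ → 𝟙*𝟙≤ˡ (p i) _)) pk)
        (∑<-mono-≤ m (λ i _ → 𝟙*𝟙≤ʳ (p i) _))) ⟩
  layers m M k f ∎
  where open ≤-Reasoning

∑<-permute : ∀ m (g h : ℕ → ℕ) → (∀ j → j < m → g j < m) →
  (∀ i j → i < m → j < m → g i ≡ g j → i ≡ j) → ∑[ j < m ] h (g j) ≡ ∑< m h
∑<-permute m g h gm inj = begin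
  ∑[ j < m ] h (g j) ≡⟨ ∑<-fibres m m g (λ j → h (g j)) (λ j j<m → inj₂ (gm j j<m)) ⟩
  ∑[ v < m ] (∑[ j < m ] (𝟙 (g j ≡ᵇ v) * h (g j))) ≡⟨ ∑<-cong m (λ v _ → ∑<-cong m (λ j _ → pointwise v j)) ⟩
  ∑[ v < m ] (∑[ j < m ] (h v * 𝟙 (g j ≡ᵇ v))) ≡⟨ ∑<-cong m (λ v _ → sym (∑<-*-distribˡ m (h v) _)) ⟩
  ∑[ v < m ] (h v * fibreSize v) ≡⟨ ∑<-cong m (λ v v<m → trans (cong (h v *_) (fibreSize≡1 v v<m)) (*-identityʳ (h v))) ⟩
  ∑< m h ∎
  where
  open ≡-Reasoning
  fibreSize : ℕ → ℕ
  fibreSize v = ∑[ j < m ] 𝟙 (g j ≡ᵇ v)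
  pointwise : ∀ v j → 𝟙 (g j ≡ᵇ v) * h (g j) ≡ h v * 𝟙 (g j ≡ᵇ v)
  pointwise v j with g j ≡ᵇ v in e
  ... | false = sym (*-zeroʳ (h v))
  ... | true rewrite ≡ᵇ⇒≡ (g j) v (subst T (sym e) _) = trans (+-identityʳ (h v)) (sym (*-identityʳ (h v)))
  fibreSize≤1 : ∀ v → v < m → fibreSize v ≤ 1
  fibreSize≤1 v _ = ∑<-atMostOne m (λ j → g j ≡ᵇ v)
    (λ i j i<m j<m ti tj → inj i j i<m j<m (trans (≡ᵇ⇒≡ _ _ ti) (sym (≡ᵇ⇒≡ _ _ tj))))
  ∑fibreSize : ∑< m fibreSize ≡ ∑[ _ < m ] 1
  ∑fibreSize = begin
    ∑< m fibreSize ≡⟨ ∑<-cong m (λ v _ → ∑<-cong m (λ j _ → sym (*-identityʳ _))) ⟩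
    ∑[ v < m ] (∑[ j < m ] (𝟙 (g j ≡ᵇ v) * 1)) ≡⟨ sym (∑<-fibres m m g (λ _ → 1) (λ j j<m → inj₂ (gm j j<m))) ⟩
    ∑[ _ < m ] 1 ∎
  fibreSize≡1 : ∀ v → v < m → fibreSize v ≡ 1
  fibreSize≡1 = ∑<-≤-equal m fibreSize≤1 ∑fibreSize

-- i outranks j: i precedes j when sorting by decreasing f with ties broken by index, as in phi.
outranksᵇ : (ℕ → ℕ) → ℕ → ℕ → Bool
outranksᵇ f j i = (f j <ᵇ f i) ∨ ((f j ≡ᵇ f i) ∧ (j <ᵇ i))

rank : ℕ → (ℕ → ℕ) → ℕ → ℕ
rank m f j = ∑[ i < m ] 𝟙 (outranksᵇ f j i)

Outranks : (ℕ → ℕ) → ℕ → ℕ → Set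
Outranks f j i = f j < f i ⊎ (f j ≡ f i × j < i)

outranksᵇ⇒ : ∀ f j i → T (outranksᵇ f j i) → Outranks f j i
outranksᵇ⇒ f j i t with T∨ {f j <ᵇ f i} t
... | inj₁ a = inj₁ (<ᵇ⇒< _ _ a)
... | inj₂ b = inj₂ (≡ᵇ⇒≡ _ _ (T∧₁ b) , <ᵇ⇒< _ _ (T∧₂ {f j ≡ᵇ f i} b))

outranks⇒ᵇ : ∀ f j i → Outranks f j i → T (outranksᵇ f j i)
outranks⇒ᵇ f j i (inj₁ lt) = ∨T₁ (<⇒<ᵇ lt)
outranks⇒ᵇ f j i (inj₂ (e , lt)) = ∨T₂ {f j <ᵇ f i} (T∧ (≡⇒≡ᵇ _ _ e) (<⇒<ᵇ lt))

Outranks-irrefl : ∀ f j → ¬ Outranks f j j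
Outranks-irrefl f j (inj₁ lt) = <-irrefl refl lt
Outranks-irrefl f j (inj₂ (_ , lt)) = <-irrefl refl lt

Outranks-trans : ∀ f a b c → Outranks f a b → Outranks f b c → Outranks f a c
Outranks-trans f a b c (inj₁ x) (inj₁ y) = inj₁ (<-trans x y)
Outranks-trans f a b c (inj₁ x) (inj₂ (e , _)) = inj₁ (<-≤-trans x (≤-reflexive e))
Outranks-trans f a b c (inj₂ (e , _)) (inj₁ y) = inj₁ (≤-<-trans (≤-reflexive e) y)
Outranks-trans f a b c (inj₂ (e , x)) (inj₂ (e' , y)) = inj₂ (trans e e' , <-trans x y)

Outranks-total : ∀ f i j → i ≢ j → Outranks f j i ⊎ Outranks f i j
Outranks-total f i j ne with <-cmp (f j) (f i)
... | tri< lt _ _ = inj₁ (inj₁ lt)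
... | tri> _ _ gt = inj₂ (inj₁ gt)
... | tri≈ _ e _ with <-cmp j i
...   | tri< lt _ _ = inj₁ (inj₂ (e , lt))
...   | tri≈ _ e' _ = ⊥-elim (ne (sym e'))
...   | tri> _ _ gt = inj₂ (inj₂ (sym e , gt))

Outranks⇒≤ : ∀ f j i → Outranks f j i → f j ≤ f i
Outranks⇒≤ f j i (inj₁ lt) = <⇒≤ lt
Outranks⇒≤ f j i (inj₂ (e , _)) = ≤-reflexive e

rank< : ∀ m f j → j < m → rank m f j < m
rank< m f j j<m = <-≤-trans
  (∑<-mono-< m {λ i → 𝟙 (outranksᵇ f j i)} {λ _ → 1} (λ i _ → 𝟙≤1 _) j j<m
     (subst (_< 1) (sym (𝟙-¬T (outranksᵇ f j j) (λ t → Outranks-irrefl f j (outranksᵇ⇒ f j j t)))) z<s))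
  (≤-reflexive (trans (∑<-const m 1) (*-identityʳ m)))

rank-anti : ∀ m f i j → i < m → Outranks f j i → rank m f i < rank m f j
rank-anti m f i j i<m ab = ∑<-mono-< m mono i i<m strict
  where
  mono : ∀ k → k < m → 𝟙 (outranksᵇ f i k) ≤ 𝟙 (outranksᵇ f j k)
  mono k _ with outranksᵇ f i k in e
  ... | false = z≤n
  ... | true = ≤-reflexive
    (sym (𝟙-T (outranksᵇ f j k) (outranks⇒ᵇ f j k (Outranks-trans f j i k ab (outranksᵇ⇒ f i k (subst T (sym e) _))))))
  strict : 𝟙 (outranksᵇ f i i) < 𝟙 (outranksᵇ f j i)
  strict rewrite 𝟙-¬T (outranksᵇ f i i) (λ t → Outranks-irrefl f i (outranksᵇ⇒ f i i t)) | 𝟙-T (outranksᵇ f j i) (outranks⇒ᵇ f j i ab) = z<s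

rank-injective : ∀ m f i j → i < m → j < m → rank m f i ≡ rank m f j → i ≡ j
rank-injective m f i j i<m j<m e with i ≟ j
... | yes p = p
... | no ne with Outranks-total f i j ne
...   | inj₁ ab = ⊥-elim (<-irrefl e (rank-anti m f i j i<m ab))
...   | inj₂ ab = ⊥-elim (<-irrefl (sym e) (rank-anti m f j i j<m ab))

∑<-rank : ∀ m f (h : ℕ → ℕ) → ∑[ j < m ] h (rank m f j) ≡ ∑< m h
∑<-rank m f h = ∑<-permute m (rank m f) h (rank< m f) (rank-injective m f)

∑<-below-⊓ : ∀ m k → ∑[ i < m ] 𝟙 (i <ᵇ k) ≡ k ⊓ m
∑<-below-⊓ zero k = sym (⊓-zeroʳ k)
∑<-below-⊓ (suc m) zero = ∑<-zero (suc m) (λ i _ → refl)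
∑<-below-⊓ (suc m) (suc k) = cong suc (∑<-below-⊓ m k)

∑<-rank< : ∀ m f k → ∑[ j < m ] 𝟙 (rank m f j <ᵇ k) ≡ k ⊓ m
∑<-rank< m f k = trans (∑<-rank m f (λ r → 𝟙 (r <ᵇ k))) (∑<-below-⊓ m k)

countAbove≤ : ∀ m t f → countAbove m t f ≤ m
countAbove≤ m t f = ∑<-≤1 m (λ i _ → 𝟙≤1 _)

countAbove⊓≤topRanked : ∀ m k f t → k ⊓ countAbove m t f ≤ ∑[ j < m ] (𝟙 (rank m f j <ᵇ k) * 𝟙 (t <ᵇ f j))
countAbove⊓≤topRanked m k f t with ∑[ j < m ] 𝟙 ((t <ᵇ f j) ∧ not (rank m f j <ᵇ k)) in e
... | zero = ≤-trans (m⊓n≤n k _) (∑<-mono-≤ m above⇒ranked)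
  where
  above⇒ranked : ∀ j → j < m → 𝟙 (t <ᵇ f j) ≤ 𝟙 (rank m f j <ᵇ k) * 𝟙 (t <ᵇ f j)
  above⇒ranked j j<m with t <ᵇ f j in e1 | rank m f j <ᵇ k in e2
  ... | false | _ = z≤n
  ... | true | true = ≤-refl
  ... | true | false with ∑<-≡0⇒ m _ e j j<m
  ... | eq rewrite e1 | e2 with eq
  ... | ()
... | suc _ with ∑<-positive m (λ j → 𝟙 ((t <ᵇ f j) ∧ not (rank m f j <ᵇ k))) (subst (0 <_) (sym e) z<s)
... | j0 , j0<m , pos = ≤-trans (⊓-monoʳ-≤ k (countAbove≤ m t f))
  (≤-trans (≤-reflexive (sym (∑<-rank< m f k))) (∑<-mono-≤ m ranked⇒above))
  where
  tj0 : T ((t <ᵇ f j0) ∧ not (rank m f j0 <ᵇ k))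
  tj0 with (t <ᵇ f j0) ∧ not (rank m f j0 <ᵇ k)
  tj0 | true = _
  tj0 | false = ⊥-elim (<-irrefl refl pos)
  t<fj0 : t < f j0
  t<fj0 = <ᵇ⇒< t (f j0) (T∧₁ tj0)
  nlt : ¬ (rank m f j0 < k)
  nlt lt with rank m f j0 <ᵇ k in e3 | T∧₂ {t <ᵇ f j0} tj0
  ... | false | _ = subst T e3 (<⇒<ᵇ lt)
  ... | true | ()
  ranked⇒above : ∀ j → j < m → 𝟙 (rank m f j <ᵇ k) ≤ 𝟙 (rank m f j <ᵇ k) * 𝟙 (t <ᵇ f j)
  ranked⇒above j j<m with rank m f j <ᵇ k in e2
  ... | false = z≤n
  ... | true = ≤-reflexive (sym (trans (+-identityʳ _) (𝟙-T (t <ᵇ f j) (<⇒<ᵇ t<fj))))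
    where
    rj<k : rank m f j < k
    rj<k = <ᵇ⇒< _ _ (subst T (sym e2) _)
    t<fj : t < f j
    t<fj with j ≟ j0
    ... | yes refl = ⊥-elim (nlt rj<k)
    ... | no ne with Outranks-total f j j0 ne
    ...   | inj₁ ab = <-≤-trans t<fj0 (Outranks⇒≤ f j0 j ab)
    ...   | inj₂ ab = ⊥-elim (nlt (<-trans (rank-anti m f j0 j j0<m ab) rj<k))

layers≤topRankedSum : ∀ m M k f → (∀ i → i < m → f i ≤ M) →
  layers m M k f ≤ ∑[ j < m ] (𝟙 (rank m f j <ᵇ k) * f j)
layers≤topRankedSum m M k f fM = begin
  layers m M k f ≤⟨ ∑<-mono-≤ M (λ t _ → countAbove⊓≤topRanked m k f t) ⟩
  ∑[ t < M ] (∑[ j < m ] (𝟙 (rank m f j <ᵇ k) * 𝟙 (t <ᵇ f j))) ≡⟨ sym (∑<-comm m M _) ⟩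
  ∑[ j < m ] (∑[ t < M ] (𝟙 (rank m f j <ᵇ k) * 𝟙 (t <ᵇ f j)))
    ≡⟨ ∑<-cong m (λ j _ → sym (∑<-*-distribˡ M (𝟙 (rank m f j <ᵇ k)) (λ t → 𝟙 (t <ᵇ f j)))) ⟩
  ∑[ j < m ] (𝟙 (rank m f j <ᵇ k) * ∑[ t < M ] 𝟙 (t <ᵇ f j))
    ≡⟨ ∑<-cong m (λ j j<m → cong (𝟙 (rank m f j <ᵇ k) *_) (∑<-below M (f j) (fM j j<m))) ⟩
  ∑[ j < m ] (𝟙 (rank m f j <ᵇ k) * f j) ∎
  where open ≤-Reasoning

countAboveL : ℕ → List ℕ → ℕ
countAboveL t x = length (filterᵇ (t <ᵇ_) x)

-- The sum of the k largest parts (sum-take-sortDec≡top), in a form invariant under permutations.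
top : ℕ → List ℕ → ℕ
top k x = ∑[ t < (sum x) ] (k ⊓ countAboveL t x)

countAboveL-∷ : ∀ t h x → countAboveL t (h ∷ x) ≡ 𝟙 (t <ᵇ h) + countAboveL t x
countAboveL-∷ t h x with t <ᵇ h
... | true = refl
... | false = refl

sum≡∑<nth : ∀ x → sum x ≡ ∑< (length x) (nth x)
sum≡∑<nth [] = refl
sum≡∑<nth (h ∷ x) = cong (h +_) (sum≡∑<nth x)

countAbove-nth : ∀ t x → countAbove (length x) t (nth x) ≡ countAboveL t x
countAbove-nth t [] = refl
countAbove-nth t (h ∷ x) = trans (cong (𝟙 (t <ᵇ h) +_) (countAbove-nth t x)) (sym (countAboveL-∷ t h x))

nth≤sum : ∀ x i → nth x i ≤ sum x
nth≤sum [] i = z≤n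
nth≤sum (h ∷ x) zero = m≤m+n h _
nth≤sum (h ∷ x) (suc i) = ≤-trans (nth≤sum x i) (m≤n+m _ h)

nth-beyond : ∀ x i → length x ≤ i → nth x i ≡ 0
nth-beyond [] i _ = refl
nth-beyond (h ∷ x) (suc i) (s≤s le) = nth-beyond x i le

top≡layers-nth : ∀ k x → top k x ≡ layers (length x) (sum x) k (nth x)
top≡layers-nth k x = ∑<-cong (sum x) (λ t _ → cong (k ⊓_) (sym (countAbove-nth t x)))

countAboveL-↭ : ∀ t {x y} → x ↭ y → countAboveL t x ≡ countAboveL t y
countAboveL-↭ t ↭.refl = refl
countAboveL-↭ t (↭.prep h p) = trans (countAboveL-∷ t h _)
  (trans (cong (𝟙 (t <ᵇ h) +_) (countAboveL-↭ t p)) (sym (countAboveL-∷ t h _)))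
countAboveL-↭ t {a ∷ b ∷ xs} {_ ∷ _ ∷ ys} (↭.swap a b p) = begin
  countAboveL t (a ∷ b ∷ xs) ≡⟨ countAboveL-∷ t a _ ⟩
  𝟙 (t <ᵇ a) + countAboveL t (b ∷ xs) ≡⟨ cong (𝟙 (t <ᵇ a) +_) (countAboveL-∷ t b _) ⟩
  𝟙 (t <ᵇ a) + (𝟙 (t <ᵇ b) + countAboveL t xs) ≡⟨ cong (λ z → 𝟙 (t <ᵇ a) + (𝟙 (t <ᵇ b) + z)) (countAboveL-↭ t p) ⟩
  𝟙 (t <ᵇ a) + (𝟙 (t <ᵇ b) + countAboveL t ys) ≡⟨ sym (+-assoc (𝟙 (t <ᵇ a)) _ _) ⟩
  𝟙 (t <ᵇ a) + 𝟙 (t <ᵇ b) + countAboveL t ys ≡⟨ cong (_+ countAboveL t ys) (+-comm (𝟙 (t <ᵇ a)) _) ⟩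
  𝟙 (t <ᵇ b) + 𝟙 (t <ᵇ a) + countAboveL t ys ≡⟨ +-assoc (𝟙 (t <ᵇ b)) _ _ ⟩
  𝟙 (t <ᵇ b) + (𝟙 (t <ᵇ a) + countAboveL t ys) ≡⟨ cong (𝟙 (t <ᵇ b) +_) (sym (countAboveL-∷ t a _)) ⟩
  𝟙 (t <ᵇ b) + countAboveL t (a ∷ ys) ≡⟨ sym (countAboveL-∷ t b _) ⟩
  countAboveL t (b ∷ a ∷ ys) ∎
  where open ≡-Reasoning
countAboveL-↭ t (↭.trans p q) = trans (countAboveL-↭ t p) (countAboveL-↭ t q)

top-↭ : ∀ k {x y} → x ↭ y → top k x ≡ top k y
top-↭ k {x} {y} p rewrite sum-↭ p = ∑<-cong (sum y) (λ t _ → cong (k ⊓_) (countAboveL-↭ t p))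

isPositive : ℕ → Bool
isPositive x = 0 <ᵇ x

countAboveL-filter-positive : ∀ t x → countAboveL t (filterᵇ isPositive x) ≡ countAboveL t x
countAboveL-filter-positive t [] = refl
countAboveL-filter-positive t (zero ∷ x) = trans (countAboveL-filter-positive t x) (sym (countAboveL-∷ t 0 x))
countAboveL-filter-positive t (suc h ∷ x) = trans (countAboveL-∷ t (suc h) _)
  (trans (cong (𝟙 (t <ᵇ suc h) +_) (countAboveL-filter-positive t x)) (sym (countAboveL-∷ t (suc h) x)))

sum-filter-positive : ∀ x → sum (filterᵇ isPositive x) ≡ sum x
sum-filter-positive [] = refl
sum-filter-positive (zero ∷ x) = sum-filter-positive x
sum-filter-positive (suc h ∷ x) = cong (suc h +_) (sum-filter-positive x)

top-filter-positive : ∀ k x → top k (filterᵇ isPositive x) ≡ top k x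
top-filter-positive k x rewrite sum-filter-positive x = ∑<-cong (sum x)
  (λ t _ → cong (k ⊓_) (countAboveL-filter-positive t x))

Decreasing : List ℕ → Set
Decreasing = AllPairs (λ a b → b ≤ a)

Decreasing-∷ʳ : ∀ {l x} → Decreasing l → All (λ a → x ≤ a) l → Decreasing (l ++ x ∷ [])
Decreasing-∷ʳ [] [] = [] ∷ []
Decreasing-∷ʳ (a ∷ d) (p ∷ ps) = ∷ʳ⁺ a p ∷ Decreasing-∷ʳ d ps

All-reverse : ∀ {P : ℕ → Set} {l} → All P l → All P (reverse l)
All-reverse [] = []
All-reverse {P} {h ∷ l} (p ∷ ps) rewrite unfold-reverse h l = ∷ʳ⁺ (All-reverse ps) p

Ascending⇒reverse-Decreasing : ∀ {l} → AllPairs _≤_ l → Decreasing (reverse l)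
Ascending⇒reverse-Decreasing [] = []
Ascending⇒reverse-Decreasing {h ∷ l} (a ∷ d) rewrite unfold-reverse h l = Decreasing-∷ʳ
  (Ascending⇒reverse-Decreasing d) (All-reverse a)

sortDec-Decreasing : ∀ x → Decreasing (sortDec x)
sortDec-Decreasing x = Ascending⇒reverse-Decreasing (Sorted⇒AllPairs ≤-totalOrder (sort-↗ (filterᵇ isPositive x)))

sortDec-↭ : ∀ x → sortDec x ↭ filterᵇ isPositive x
sortDec-↭ x = ↭.trans (↭-reverse _) (sort-↭ _)

top-sortDec : ∀ k x → top k (sortDec x) ≡ top k x
top-sortDec k x = trans (top-↭ k (sortDec-↭ x)) (top-filter-positive k x)

countAboveL-positive⇒< : ∀ {h} t y → All (_≤ h) y → 0 < countAboveL t y → t < h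
countAboveL-positive⇒< t (a ∷ y) (p ∷ ps) c with t <ᵇ a in e
... | true = <-≤-trans (<ᵇ⇒< t a (subst T (sym e) _)) p
... | false = countAboveL-positive⇒< t y ps c

⊓-step : ∀ k b c → (0 < c → T b) → suc k ⊓ (𝟙 b + c) ≡ 𝟙 b + k ⊓ c
⊓-step k true c _ = refl
⊓-step k false zero _ = sym (⊓-zeroʳ k)
⊓-step k false (suc c) h = ⊥-elim (h z<s)

Decreasing-top : ∀ k y M → Decreasing y → sum y ≤ M → ∑[ t < M ] (k ⊓ countAboveL t y) ≡ sum (take k y)
Decreasing-top zero y M d le = ∑<-zero M (λ _ _ → refl)
Decreasing-top (suc k) [] M d le = ∑<-zero M (λ _ _ → refl)
Decreasing-top (suc k) (h ∷ y) M (a ∷ d) le = begin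
  ∑[ t < M ] (suc k ⊓ countAboveL t (h ∷ y)) ≡⟨ ∑<-cong M (λ t _ → trans (cong (suc k ⊓_) (countAboveL-∷ t h y))
        (⊓-step k (t <ᵇ h) (countAboveL t y) (λ c → <⇒<ᵇ (countAboveL-positive⇒< t y a c)))) ⟩
  ∑[ t < M ] (𝟙 (t <ᵇ h) + k ⊓ countAboveL t y) ≡⟨ ∑<-distrib-+ M _ _ ⟩
  ∑[ t < M ] 𝟙 (t <ᵇ h) + ∑[ t < M ] (k ⊓ countAboveL t y) ≡⟨ cong₂ _+_ (∑<-below M h (≤-trans (m≤m+n h _) le))
        (Decreasing-top k y M d (≤-trans (m≤n+m _ h) le)) ⟩
  h + sum (take k y) ∎
  where open ≡-Reasoning

sum-take-sortDec≡top : ∀ k x → sum (take k (sortDec x)) ≡ top k x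
sum-take-sortDec≡top k x = trans
  (sym (Decreasing-top k (sortDec x) (sum (sortDec x)) (sortDec-Decreasing x) ≤-refl)) (top-sortDec k x)

∑<-countAboveL : ∀ x M → sum x ≤ M → ∑[ t < M ] countAboveL t x ≡ sum x
∑<-countAboveL x M le = begin
  ∑[ t < M ] countAboveL t x ≡⟨ ∑<-cong M (λ t _ → sym (countAbove-nth t x)) ⟩
  ∑[ t < M ] (∑[ i < (length x) ] 𝟙 (t <ᵇ nth x i)) ≡⟨ sym (∑<-comm (length x) M _) ⟩
  ∑[ i < (length x) ] (∑[ t < M ] 𝟙 (t <ᵇ nth x i))
    ≡⟨ ∑<-cong (length x) (λ i _ → ∑<-below M (nth x i) (≤-trans (nth≤sum x i) le)) ⟩
  ∑< (length x) (nth x) ≡⟨ sym (sum≡∑<nth x) ⟩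
  sum x ∎
  where open ≡-Reasoning

countAboveL≤length : ∀ t x → countAboveL t x ≤ length x
countAboveL≤length t [] = z≤n
countAboveL≤length t (h ∷ x) with t <ᵇ h
... | true = s≤s (countAboveL≤length t x)
... | false = ≤-trans (countAboveL≤length t x) (n≤1+n _)

top-≥length : ∀ k x → length x ≤ k → top k x ≡ sum x
top-≥length k x le = trans (∑<-cong (sum x) (λ t _ → m≥n⇒m⊓n≡n (≤-trans (countAboveL≤length t x) le)))
  (∑<-countAboveL x (sum x) ≤-refl)

countAboveL-0 : ∀ x → All (λ y → 0 < y) x → countAboveL 0 x ≡ length x
countAboveL-0 [] [] = refl
countAboveL-0 (suc h ∷ x) (_ ∷ ps) = cong suc (countAboveL-0 x ps)

nth-positive : ∀ γ → All (λ x → 0 < x) γ → ∀ i → i < length γ → 0 < nth γ i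
nth-positive (g ∷ γ) (p ∷ _) zero _ = p
nth-positive (g ∷ γ) (_ ∷ ps) (suc i) (s<s i<) = nth-positive γ ps i i<

top-<length : ∀ k x → All (λ y → 0 < y) x → k < length x → top k x < sum x
top-<length k (h ∷ x) (ph ∷ ps) lt = <-≤-trans
  (∑<-mono-< (sum (h ∷ x)) (λ t _ → m⊓n≤n k (countAboveL t (h ∷ x))) 0 (<-≤-trans ph (m≤m+n h _))
     (subst (k ⊓ countAboveL 0 (h ∷ x) <_) (sym (countAboveL-0 (h ∷ x) (ph ∷ ps)))
       (subst (_< length (h ∷ x)) (sym (trans (cong (k ⊓_) (countAboveL-0 (h ∷ x) (ph ∷ ps))) (m≤n⇒m⊓n≡m (<⇒≤ lt)))) lt)))
  (≤-reflexive (∑<-countAboveL (h ∷ x) (sum (h ∷ x)) ≤-refl))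

top-⊓ : ∀ k x B → length x ≤ B → top (k ⊓ B) x ≡ top k x
top-⊓ k x B le = ∑<-cong (sum x)
  (λ t _ → trans (⊓-assoc k B _) (cong (k ⊓_) (m≥n⇒m⊓n≡n (≤-trans (countAboveL≤length t x) le))))

-- The local definitions m, b and rank of phi.
phiLength : List ℕ → List ℕ → ℕ
phiLength lam β = length lam ⊔ length β

phiPadded : List ℕ → List ℕ → List ℕ
phiPadded lam β = β ++ replicate (length lam ∸ length β) 0

phiRank : List ℕ → List ℕ → ℕ → ℕ
phiRank lam β j = length (filterᵇ (outranksᵇ (nth (phiPadded lam β)) j) (upTo (phiLength lam β)))

length-filterᵇ-applyUpTo : ∀ (p : ℕ → Bool) (f : ℕ → ℕ) m → length (filterᵇ p (applyUpTo f m)) ≡ ∑[ i < m ] 𝟙 (p (f i))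
length-filterᵇ-applyUpTo p f zero = refl
length-filterᵇ-applyUpTo p f (suc m) with p (f 0)
... | true = cong suc (length-filterᵇ-applyUpTo p (f ∘ suc) m)
... | false = length-filterᵇ-applyUpTo p (f ∘ suc) m

nth-map-applyUpTo : ∀ (g f : ℕ → ℕ) m j → j < m → nth (map g (applyUpTo f m)) j ≡ g (f j)
nth-map-applyUpTo g f (suc m) zero _ = refl
nth-map-applyUpTo g f (suc m) (suc j) (s<s j<m) = nth-map-applyUpTo g (f ∘ suc) m j j<m

phiRank≡rank : ∀ lam β j → phiRank lam β j ≡ rank (phiLength lam β) (nth (phiPadded lam β)) j
phiRank≡rank lam β j = length-filterᵇ-applyUpTo _ id (phiLength lam β)

layers-cong : ∀ m M k {f g : ℕ → ℕ} → (∀ i → i < m → f i ≡ g i) → layers m M k f ≡ layers m M k g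
layers-cong m M k h = ∑<-cong M (λ t _ → cong (k ⊓_) (∑<-cong m (λ i i<m → cong (λ z → 𝟙 (t <ᵇ z)) (h i i<m))))

layers-width : ∀ m m' M k f → m ≤ m' → (∀ i → m ≤ i → f i ≡ 0) → layers m' M k f ≡ layers m M k f
layers-width m m' M k f le h = ∑<-cong M
  (λ t _ → cong (k ⊓_) (∑<-extend m m' le (λ i mi → trans (cong (λ z → 𝟙 (t <ᵇ z)) (h i mi)) (𝟙-<ᵇ-≥ t 0 z≤n))))

nth-++-zeros : ∀ x r i → nth (x ++ replicate r 0) i ≡ nth x i
nth-++-zeros [] zero zero = refl
nth-++-zeros [] zero (suc i) = refl
nth-++-zeros [] (suc r) zero = refl
nth-++-zeros [] (suc r) (suc i) = nth-++-zeros [] r i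
nth-++-zeros (h ∷ x) r zero = refl
nth-++-zeros (h ∷ x) r (suc i) = nth-++-zeros x r i

top≡layers : ∀ k x m M → length x ≤ m → sum x ≤ M → top k x ≡ layers m M k (nth x)
top≡layers k x m M lm sM = trans (top≡layers-nth k x) (trans
  (sym (layers-height (length x) (sum x) M k (nth x) sM (λ i _ → nth≤sum x i)))
  (sym (layers-width (length x) m M k (nth x) lm (nth-beyond x))))

sum-take≡∑< : ∀ k x m → length x ≤ m → sum (take k x) ≡ ∑[ r < m ] (𝟙 (r <ᵇ k) * nth x r)
sum-take≡∑< zero x m _ = sym (∑<-zero m (λ r _ → refl))
sum-take≡∑< (suc k) [] m _ = sym (∑<-zero m (λ r _ → *-zeroʳ (𝟙 (r <ᵇ suc k))))
sum-take≡∑< (suc k) (h ∷ x) (suc m) (s≤s le) = cong₂ _+_ (sym (+-identityʳ h)) (sum-take≡∑< k x m le)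

IsPartition⇒Decreasing : ∀ {x} → IsPartition x → Decreasing x
IsPartition⇒Decreasing [] = []
IsPartition⇒Decreasing [ _ ] = [] ∷ []
IsPartition⇒Decreasing (y≤x ∷ p) with IsPartition⇒Decreasing p
... | (a ∷ d) = (y≤x ∷ allTrans a) ∷ (a ∷ d)
  where
  allTrans : ∀ {l} → All (_≤ _) l → All (_≤ _) l
  allTrans [] = []
  allTrans (q ∷ qs) = ≤-trans q y≤x ∷ allTrans qs

top-partition : ∀ k x m → IsPartition x → length x ≤ m → top k x ≡ ∑[ r < m ] (𝟙 (r <ᵇ k) * nth x r)
top-partition k x m p le = trans (Decreasing-top k x (sum x) (IsPartition⇒Decreasing p) ≤-refl) (sum-take≡∑< k x m le)

top-phi : ∀ k lam β → IsPartition lam → top k lam + top k β ≤ top k (phi lam β)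
top-phi k lam β part = begin
  top k lam + top k β
    ≤⟨ +-mono-≤ (≤-reflexive top-lam) (≤-trans (≤-reflexive top-β) (layers≤topRankedSum m (sum β) k fb fbM)) ⟩
  ∑[ r < m ] (𝟙 (r <ᵇ k) * L r) + ∑[ j < m ] (𝟙 (rank m fb j <ᵇ k) * fb j)
     ≡⟨ cong₂ _+_ (sym (∑<-rank m fb (λ r → 𝟙 (r <ᵇ k) * L r))) refl ⟩
  ∑[ j < m ] (𝟙 (rank m fb j <ᵇ k) * L (rank m fb j)) + ∑[ j < m ] (𝟙 (rank m fb j <ᵇ k) * fb j)
     ≡⟨ sym (∑<-distrib-+ m _ _) ⟩
  ∑[ j < m ] (𝟙 (rank m fb j <ᵇ k) * L (rank m fb j) + 𝟙 (rank m fb j <ᵇ k) * fb j)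
     ≡⟨ ∑<-cong m (λ j _ → trans (sym (*-distribˡ-+ (𝟙 (rank m fb j <ᵇ k)) _ _)) (cong (𝟙 (rank m fb j <ᵇ k) *_) (+-comm _ (fb j)))) ⟩
  ∑[ j < m ] (𝟙 (rank m fb j <ᵇ k) * g j) ≤⟨ subsetSum≤layers m (sum (phi lam β)) k (λ j → rank m fb j <ᵇ k) g
        (≤-trans (≤-reflexive (∑<-rank< m fb k)) (m⊓n≤m k m))
        (λ i i<m → subst (_≤ sum (phi lam β)) (gφ i i<m) (nth≤sum (phi lam β) i)) ⟩
  layers m (sum (phi lam β)) k g ≡⟨ layers-cong m (sum (phi lam β)) k (λ i i<m → sym (gφ i i<m)) ⟩
  layers m (sum (phi lam β)) k (nth (phi lam β))
    ≡⟨ sym (top≡layers k (phi lam β) m (sum (phi lam β)) (≤-reflexive lenφ) ≤-refl) ⟩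
  top k (phi lam β) ∎
  where
  open ≤-Reasoning
  m : ℕ
  m = phiLength lam β
  fb L : ℕ → ℕ
  fb = nth (phiPadded lam β)
  L = nth lam
  g : ℕ → ℕ
  g j = fb j + L (rank m fb j)
  gφ : ∀ i → i < m → nth (phi lam β) i ≡ g i
  gφ i i<m = trans (nth-map-applyUpTo (λ j → nth (phiPadded lam β) j + nth lam (phiRank lam β j)) id m i i<m)
                (cong (λ z → fb i + L z) (phiRank≡rank lam β i))
  lenφ : length (phi lam β) ≡ m
  lenφ = trans (length-map _ (upTo m)) (length-upTo m)
  top-lam : top k lam ≡ ∑[ r < m ] (𝟙 (r <ᵇ k) * L r)
  top-lam = top-partition k lam m part (m≤m⊔n _ _)
  fbβ : ∀ i → fb i ≡ nth β i
  fbβ i = nth-++-zeros β (length lam ∸ length β) i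
  fbM : ∀ i → i < m → fb i ≤ sum β
  fbM i _ = subst (_≤ sum β) (sym (fbβ i)) (nth≤sum β i)
  top-β : top k β ≡ layers m (sum β) k fb
  top-β = trans (top≡layers k β m (sum β) (m≤n⊔m _ _) ≤-refl) (layers-cong m (sum β) k (λ i _ → sym (fbβ i)))

-- Rows and columns are indexed from 0 here, unlike entry in Defs.
cell : List (List ℕ) → ℕ → ℕ → ℕ
cell τ i c = nth (nthRow τ i) c

rowLength : List (List ℕ) → ℕ → ℕ
rowLength τ i = length (nthRow τ i)

∑cells : (ℕ → ℕ) → List (List ℕ) → ℕ
∑cells h τ = ∑[ i < (length τ) ] (∑[ c < (rowLength τ i) ] h (cell τ i c))

countᵇ : (ℕ → Bool) → List ℕ → ℕ
countᵇ p r = length (filterᵇ p r)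

countᵇ≡∑< : ∀ p r → countᵇ p r ≡ ∑[ c < (length r) ] 𝟙 (p (nth r c))
countᵇ≡∑< p [] = refl
countᵇ≡∑< p (x ∷ r) with p x
... | true = cong suc (countᵇ≡∑< p r)
... | false = countᵇ≡∑< p r

countᵇ-++ : ∀ p r s → countᵇ p (r ++ s) ≡ countᵇ p r + countᵇ p s
countᵇ-++ p [] s = refl
countᵇ-++ p (x ∷ r) s with p x
... | true = cong suc (countᵇ-++ p r s)
... | false = countᵇ-++ p r s

countᵇ-concat : ∀ p τ → countᵇ p (concat τ) ≡ ∑cells (λ x → 𝟙 (p x)) τ
countᵇ-concat p [] = refl
countᵇ-concat p (r ∷ τ) = trans (countᵇ-++ p r (concat τ)) (cong₂ _+_ (countᵇ≡∑< p r) (countᵇ-concat p τ))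

vecAt : ∀ {n} → Vec ℕ n → ℕ → ℕ
vecAt [] _ = 0
vecAt (x ∷ xs) zero = x
vecAt (x ∷ xs) (suc i) = vecAt xs i

vecAt-tabulate : ∀ n (H : ℕ → ℕ) v → v < n → vecAt (tabulate {n = n} (λ i → H (toℕ i))) v ≡ H v
vecAt-tabulate (suc n) H zero _ = refl
vecAt-tabulate (suc n) H (suc v) (s<s v<n) = vecAt-tabulate n (H ∘ suc) v v<n

vecAt-content : ∀ n τ v → v < n → vecAt (content n τ) v ≡ ∑cells (λ x → 𝟙 (x ≡ᵇ suc v)) τ
vecAt-content n τ v v<n = trans (vecAt-tabulate n (λ i → length (filterᵇ (λ x → x ≡ᵇ suc i) (concat τ))) v v<n)
  (countᵇ-concat (λ x → x ≡ᵇ suc v) τ)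

DistinctColumns : List (List ℕ) → Set
DistinctColumns τ = ∀ i j c → i < j → j < length τ → c < rowLength τ i → c < rowLength τ j → cell τ i c ≢ cell τ j c

∑<-restrict : ∀ L C (h : ℕ → ℕ) → L ≤ C → ∑< L h ≡ ∑[ c < C ] (𝟙 (c <ᵇ L) * h c)
∑<-restrict zero C h _ = sym (∑<-zero C (λ c _ → refl))
∑<-restrict (suc L) (suc C) h (s≤s le) = cong₂ _+_ (sym (+-identityʳ (h 0))) (∑<-restrict L C (h ∘ suc) le)

∑cells≤layers : ∀ τ V C k (q : ℕ → Bool) → DistinctColumns τ →
  (∀ i c → i < length τ → c < rowLength τ i → cell τ i c < V) →
  ∑[ v < V ] 𝟙 (q v) ≤ k →
  (∀ i → i < length τ → rowLength τ i ≤ C) →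
  ∑cells (λ x → 𝟙 (q x)) τ ≤ layers (length τ) C k (rowLength τ)
∑cells≤layers τ V C k q cd entV qk lenC = begin
  ∑cells (λ x → 𝟙 (q x)) τ ≡⟨ ∑<-cong ℓ (λ i i<ℓ → ∑<-restrict (rowLength τ i) C _ (lenC i i<ℓ)) ⟩
  ∑[ i < ℓ ] (∑[ c < C ] (𝟙 (c <ᵇ rowLength τ i) * 𝟙 (q (cell τ i c)))) ≡⟨ ∑<-comm ℓ C _ ⟩
  ∑[ c < C ] (∑[ i < ℓ ] (𝟙 (c <ᵇ rowLength τ i) * 𝟙 (q (cell τ i c))))
    ≤⟨ ∑<-mono-≤ C (λ c _ → ⊓-glb (colk c) (∑<-mono-≤ ℓ (λ i _ → 𝟙*𝟙≤ˡ (c <ᵇ rowLength τ i) _))) ⟩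
  layers ℓ C k (rowLength τ) ∎
  where
  open ≤-Reasoning
  ℓ : ℕ
  ℓ = length τ
  colk : ∀ c → ∑[ i < ℓ ] (𝟙 (c <ᵇ rowLength τ i) * 𝟙 (q (cell τ i c))) ≤ k
  colk c = ≤-trans (≤-reflexive (∑<-cong ℓ (λ i _ → 𝟙-∧ (c <ᵇ rowLength τ i) _)))
    (≤-trans (∑<-count-injective ℓ V (λ i → (c <ᵇ rowLength τ i) ∧ q (cell τ i c)) q (λ i → cell τ i c)
      (λ i i<ℓ t → entV i c i<ℓ (<ᵇ⇒< c _ (T∧₁ t)))
      (λ i i<ℓ t → T∧₂ {c <ᵇ rowLength τ i} t)
      inj) qk)
    where
    inj : ∀ i j → i < ℓ → j < ℓ → T ((c <ᵇ rowLength τ i) ∧ q (cell τ i c))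
      → T ((c <ᵇ rowLength τ j) ∧ q (cell τ j c)) →
          cell τ i c ≡ cell τ j c → i ≡ j
    inj i j i<ℓ j<ℓ ti tj e with <-cmp i j
    ... | tri< lt _ _ = ⊥-elim (cd i j c lt j<ℓ (<ᵇ⇒< c _ (T∧₁ ti)) (<ᵇ⇒< c _ (T∧₁ tj)) e)
    ... | tri≈ _ eq _ = eq
    ... | tri> _ _ gt = ⊥-elim (cd j i c gt i<ℓ (<ᵇ⇒< c _ (T∧₁ tj)) (<ᵇ⇒< c _ (T∧₁ ti)) (sym e))

∑<-∑cells : ∀ n (H : ℕ → ℕ → ℕ) τ → ∑[ v < n ] ∑cells (H v) τ ≡ ∑cells (λ x → ∑[ v < n ] H v x) τ
∑<-∑cells n H τ = trans (∑<-comm n (length τ) _)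
  (∑<-cong (length τ) (λ i _ → ∑<-comm n (rowLength τ i) _))

-- The entry x is the letter v + 1 of a variable x_{v+1} selected by p.
letterIn : ℕ → (ℕ → Bool) → ℕ → Bool
letterIn n p zero = false
letterIn n p (suc y) = (y <ᵇ n) ∧ p y

∑<-letterIn : ∀ n p x → ∑[ v < n ] (𝟙 (p v) * 𝟙 (x ≡ᵇ suc v)) ≡ 𝟙 (letterIn n p x)
∑<-letterIn n p zero = ∑<-zero n (λ v _ → *-zeroʳ (𝟙 (p v)))
∑<-letterIn n p (suc y) with y <ᵇ n in e
... | true = trans (∑<-cong n (λ v _ → *-comm (𝟙 (p v)) _))
  (∑<-point n y (λ v → 𝟙 (p v)) (<ᵇ⇒< y n (subst T (sym e) _)))
... | false = ∑<-zero n (λ v v<n → not-letter v v<n)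
  where
  not-letter : ∀ v → v < n → 𝟙 (p v) * 𝟙 (y ≡ᵇ v) ≡ 0
  not-letter v v<n with y ≡ᵇ v in e2
  ... | false = *-zeroʳ (𝟙 (p v))
  ... | true with subst T e (<⇒<ᵇ (subst (_< n) (sym (≡ᵇ⇒≡ y v (subst T (sym e2) _))) v<n))
  ... | ()

∑<-letterIn-count : ∀ n p → ∑[ w < (suc n) ] 𝟙 (letterIn n p w) ≡ ∑[ v < n ] 𝟙 (p v)
∑<-letterIn-count n p = ∑<-cong n (λ y y<n → cong (λ b → 𝟙 (b ∧ p y)) (y<ᵇn y y<n))
  where
  y<ᵇn : ∀ y → y < n → (y <ᵇ n) ≡ true
  y<ᵇn y y<n with y <ᵇ n in e
  ... | true = refl
  ... | false = ⊥-elim (subst T e (<⇒<ᵇ y<n))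

content≤layers : ∀ n τ (γ : List ℕ) k (p : ℕ → Bool) → DistinctColumns τ →
  length τ ≡ length γ → (∀ i → rowLength τ i ≡ nth γ i) →
  (∀ i c → i < length τ → c < rowLength τ i → 1 ≤ cell τ i c × cell τ i c ≤ n) →
  ∑[ v < n ] 𝟙 (p v) ≤ k →
  ∑[ v < n ] (𝟙 (p v) * vecAt (content n τ) v) ≤ layers (length γ) (sum γ) k (nth γ)
content≤layers n τ γ k p cd lτ lens ents pk = begin
  ∑[ v < n ] (𝟙 (p v) * vecAt (content n τ) v)
    ≡⟨ ∑<-cong n (λ v v<n → cong (𝟙 (p v) *_) (vecAt-content n τ v v<n)) ⟩
  ∑[ v < n ] (𝟙 (p v) * ∑cells (λ x → 𝟙 (x ≡ᵇ suc v)) τ) ≡⟨ ∑<-cong n (λ v _ → trans (∑<-*-distribˡ (length τ) (𝟙 (p v)) _)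
        (∑<-cong (length τ) (λ i _ → ∑<-*-distribˡ (rowLength τ i) (𝟙 (p v)) _))) ⟩
  ∑[ v < n ] (∑cells (λ x → 𝟙 (p v) * 𝟙 (x ≡ᵇ suc v)) τ) ≡⟨ ∑<-∑cells n (λ v x → 𝟙 (p v) * 𝟙 (x ≡ᵇ suc v)) τ ⟩
  ∑cells (λ x → ∑[ v < n ] (𝟙 (p v) * 𝟙 (x ≡ᵇ suc v))) τ
    ≡⟨ ∑<-cong (length τ) (λ i _ → ∑<-cong (rowLength τ i) (λ c _ → ∑<-letterIn n p (cell τ i c))) ⟩
  ∑cells (λ x → 𝟙 (letterIn n p x)) τ ≤⟨ ∑cells≤layers τ (suc n) (sum γ) k (letterIn n p) cd
       (λ i c i<ℓ c<l → s≤s (proj₂ (ents i c i<ℓ c<l)))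
       (≤-trans (≤-reflexive (∑<-letterIn-count n p)) pk)
       (λ i _ → subst (_≤ sum γ) (sym (lens i)) (nth≤sum γ i)) ⟩
  layers (length τ) (sum γ) k (rowLength τ)
    ≡⟨ trans (cong (λ z → layers z (sum γ) k (rowLength τ)) lτ) (∑<-cong (sum γ) (λ t _ → cong (k ⊓_) (∑<-cong (length γ) (λ i _ → cong (λ z → 𝟙 (t <ᵇ z)) (lens i))))) ⟩
  layers (length γ) (sum γ) k (nth γ) ∎
  where open ≤-Reasoning

-- The conjuncts of isCT and of isSSYT, which Defs defines in where blocks.
ct1ᵇ ct2ᵇ ct3ᵇ : List (List ℕ) → Bool
ct1ᵇ τ = allᵇ (λ i → allᵇ (λ k → entry τ i (suc k) ≤ᵇ entry τ i k) (range1 (length (nthRow τ (i ∸ 1)) ∸ 1)))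
  (range1 (length τ))
ct2ᵇ τ = allᵇ (λ i → allᵇ (λ j → (i <ᵇ j) ⇒ᵇ (entry τ i 1 <ᵇ entry τ j 1)) (range1 (length τ))) (range1 (length τ))
ct3ᵇ τ = allᵇ (λ i → allᵇ (λ j → (i <ᵇ j) ⇒ᵇ
          allᵇ (λ k →
            ((len j ≤ᵇ len i) ⇒ᵇ ((entry τ j k <ᵇ entry τ i k) ∨ (entry τ i (k ∸ 1) <ᵇ entry τ j k))) ∧
            ((len i <ᵇ len j) ⇒ᵇ ((entry τ j k <ᵇ entry τ i k) ∨ (entry τ i k <ᵇ entry τ j (suc k)))))
            (range1 (len i ⊓ len j)))
          (range1 (length τ))) (range1 (length τ))
  where
  len : ℕ → ℕ
  len i = length (nthRow τ (i ∸ 1))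

ssRowsᵇ ssColumnsᵇ : List (List ℕ) → Bool
ssRowsᵇ τ = allᵇ
  (λ i → allᵇ (λ k → entry τ i k ≤ᵇ entry τ i (suc k)) (range1 (length (nthRow τ (i ∸ 1)) ∸ 1))) (range1 (length τ))
ssColumnsᵇ τ = allᵇ
  (λ i → allᵇ (λ k → entry τ i k <ᵇ entry τ (suc i) k) (range1 (length (nthRow τ (suc i ∸ 1))))) (range1 (length τ ∸ 1))

allᵇ-applyUpTo⁻ : ∀ (p : ℕ → Bool) (f : ℕ → ℕ) m → T (allᵇ p (Data.List.map suc (applyUpTo f m))) → ∀ j
  → j < m → T (p (suc (f j)))
allᵇ-applyUpTo⁻ p f (suc m) t zero _ = T∧₁ t
allᵇ-applyUpTo⁻ p f (suc m) t (suc j) (s<s j<m) = allᵇ-applyUpTo⁻ p (f ∘ suc) m (T∧₂ {p (suc (f 0))} t) j j<m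

allᵇ-range1⁻ : ∀ (p : ℕ → Bool) m → T (allᵇ p (range1 m)) → ∀ j → j < m → T (p (suc j))
allᵇ-range1⁻ p m t = allᵇ-applyUpTo⁻ p id m t

allᵇ-range1⁺ : ∀ (p : ℕ → Bool) m → (∀ j → j < m → T (p (suc j))) → T (allᵇ p (range1 m))
allᵇ-range1⁺ p m h = go id m (λ j j<m → h j j<m)
  where
  go : ∀ (f : ℕ → ℕ) m → (∀ j → j < m → T (p (suc (f j)))) → T (allᵇ p (Data.List.map suc (applyUpTo f m)))
  go f zero h = _
  go f (suc m) h = T∧ (h 0 z<s) (go (f ∘ suc) m (λ j j<m → h (suc j) (s<s j<m)))

⇒ᵇ-mp : ∀ {a b} → T (a ⇒ᵇ b) → T a → T b
⇒ᵇ-mp {true} t _ = t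

T⇒ᵇ : ∀ {a b} → (T a → T b) → T (a ⇒ᵇ b)
T⇒ᵇ {true} h = h _
T⇒ᵇ {false} h = _

module CompositionTableau (τ : List (List ℕ)) (ok : T (isCT τ)) where
  ℓ : ℕ
  ℓ = length τ
  ok₁ : T (ct1ᵇ τ)
  ok₁ = T∧₁ ok
  ok₂ : T (ct2ᵇ τ)
  ok₂ = T∧₁ (T∧₂ {ct1ᵇ τ} ok)
  ok₃ : T (ct3ᵇ τ)
  ok₃ = T∧₂ {ct2ᵇ τ} (T∧₂ {ct1ᵇ τ} ok)

  ct1 : ∀ a c → a < ℓ → suc c < rowLength τ a → cell τ a (suc c) ≤ cell τ a c
  ct1 a c a<ℓ sc<l = ≤ᵇ⇒≤ _ _ (allᵇ-range1⁻ _ _ (allᵇ-range1⁻ _ ℓ ok₁ a a<ℓ) c (∸-monoˡ-≤ 1 sc<l))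

  ct2 : ∀ a b → a < b → b < ℓ → cell τ a 0 < cell τ b 0
  ct2 a b a<b b<ℓ = <ᵇ⇒< _ _ (⇒ᵇ-mp (allᵇ-range1⁻ _ ℓ (allᵇ-range1⁻ _ ℓ ok₂ a (<-trans a<b b<ℓ)) b b<ℓ) (<⇒<ᵇ (s<s a<b)))

  ct3 : ∀ a b c → a < b → b < ℓ → c < rowLength τ a → c < rowLength τ b →
    (rowLength τ b ≤ rowLength τ a → cell τ b c < cell τ a c ⊎ entry τ (suc a) c < cell τ b c) ×
    (rowLength τ a < rowLength τ b → cell τ b c < cell τ a c ⊎ cell τ a c < cell τ b (suc c))
  ct3 a b c a<b b<ℓ ca cb = (λ le → case-≥ (⇒ᵇ-mp (T∧₁ ok₃-at) (≤⇒≤ᵇ le))) ,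
    (λ lt → case-< (⇒ᵇ-mp (T∧₂ ok₃-at) (<⇒<ᵇ lt)))
    where
    ok₃-at : T (((rowLength τ b ≤ᵇ rowLength τ a) ⇒ᵇ ((cell τ b c <ᵇ cell τ a c) ∨ (entry τ (suc a) c <ᵇ cell τ b c)))
               ∧ ((rowLength τ a <ᵇ rowLength τ b) ⇒ᵇ ((cell τ b c <ᵇ cell τ a c) ∨ (cell τ a c <ᵇ cell τ b (suc c)))))
    ok₃-at = allᵇ-range1⁻ _ _
      (⇒ᵇ-mp (allᵇ-range1⁻ _ ℓ (allᵇ-range1⁻ _ ℓ ok₃ a (<-trans a<b b<ℓ)) b b<ℓ) (<⇒<ᵇ (s<s a<b))) c (⊓-glb ca cb)
    case-≥ : T ((cell τ b c <ᵇ cell τ a c) ∨ (entry τ (suc a) c <ᵇ cell τ b c))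
      → cell τ b c < cell τ a c ⊎ entry τ (suc a) c < cell τ b c
    case-≥ t with cell τ b c <ᵇ cell τ a c in e
    ... | true = inj₁ (<ᵇ⇒< _ _ (subst T (sym e) _))
    ... | false = inj₂ (<ᵇ⇒< _ _ t)
    case-< : T ((cell τ b c <ᵇ cell τ a c) ∨ (cell τ a c <ᵇ cell τ b (suc c)))
      → cell τ b c < cell τ a c ⊎ cell τ a c < cell τ b (suc c)
    case-< t with cell τ b c <ᵇ cell τ a c in e
    ... | true = inj₁ (<ᵇ⇒< _ _ (subst T (sym e) _))
    ... | false = inj₂ (<ᵇ⇒< _ _ t)

  distinctColumns : DistinctColumns τ
  distinctColumns a b c a<b b<ℓ ca cb e with ≤-<-connex (rowLength τ b) (rowLength τ a)
  ... | inj₁ le with proj₁ (ct3 a b c a<b b<ℓ ca cb) le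
  ...   | inj₁ lt = <-irrefl (sym e) lt
  ...   | inj₂ lt with c
  ...     | zero = <-irrefl e (ct2 a b a<b b<ℓ)
  ...     | suc c' = <-irrefl e (≤-<-trans (ct1 a c' (<-trans a<b b<ℓ) ca) lt)
  distinctColumns a b c a<b b<ℓ ca cb e | inj₂ lt with proj₂ (ct3 a b c a<b b<ℓ ca cb) lt
  ...   | inj₁ lt' = <-irrefl (sym e) lt'
  ...   | inj₂ lt' = <-irrefl e (<-≤-trans lt' (ct1 b c b<ℓ (<-≤-trans (s≤s ca) lt)))

module SemistandardTableau (τ : List (List ℕ)) (ok : T (isSSYT τ))
  (mono : ∀ i j → i ≤ j → j < length τ → rowLength τ j ≤ rowLength τ i) where
  ℓ : ℕ
  ℓ = length τ
  ok₂ : T (ssColumnsᵇ τ)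
  ok₂ = T∧₂ {ssRowsᵇ τ} ok

  ss2 : ∀ a c → suc a < ℓ → c < rowLength τ (suc a) → cell τ a c < cell τ (suc a) c
  ss2 a c sa<ℓ c<l = <ᵇ⇒< _ _ (allᵇ-range1⁻ _ _ (allᵇ-range1⁻ _ (ℓ ∸ 1) ok₂ a a<ℓ-1) c c<l)
    where
    a<ℓ-1 : a < ℓ ∸ 1
    a<ℓ-1 = ∸-monoˡ-< sa<ℓ (s≤s z≤n)

  chain : ∀ a b c → a < b → b < ℓ → c < rowLength τ b → cell τ a c < cell τ b c
  chain a (suc b) c a<sb sb<ℓ c<l with m≤n⇒m<n∨m≡n (≤-pred a<sb)
  ... | inj₂ refl = ss2 a c sb<ℓ c<l
  ... | inj₁ a<b = <-trans
    (chain a b c a<b (<-trans (n<1+n b) sb<ℓ) (<-≤-trans c<l (mono b (suc b) (n≤1+n b) sb<ℓ))) (ss2 b c sb<ℓ c<l)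

  distinctColumns : DistinctColumns τ
  distinctColumns a b c a<b b<ℓ ca cb e = <-irrefl e (chain a b c a<b b<ℓ cb)

-- Imported only here: the prefix +_ makes sections such as (a +_) on ℕ ambiguous.
open import Data.Integer using (ℤ; +_) renaming (_+_ to _+ℤ_; _*_ to _*ℤ_)
import Data.Integer.Properties as ℤP

filterᵇ-nonempty : ∀ {A : Set} (P : A → Bool) (L : List A) → 0 < length (filterᵇ P L) → Σ A λ x → x ∈ L × T (P x)
filterᵇ-nonempty P (x ∷ L) pos with P x in e
... | true = x , here refl , subst T (sym e) _
... | false with filterᵇ-nonempty P L pos
... | y , y∈ , py = y , there y∈ , py

∈⇒filterᵇ-nonempty : ∀ {A : Set} (P : A → Bool) (L : List A) x → x ∈ L → T (P x) → 0 < length (filterᵇ P L)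
∈⇒filterᵇ-nonempty P (y ∷ L) x (here refl) t with P y
... | true = z<s
∈⇒filterᵇ-nonempty P (y ∷ L) x (there m) t with P y
... | true = z<s
... | false = ∈⇒filterᵇ-nonempty P L x m t

∈-range1⁻ : ∀ {n x} → x ∈ range1 n → 1 ≤ x × x ≤ n
∈-range1⁻ {n} m with ∈-map⁻ suc m
... | y , y∈ , refl = s≤s z≤n , ∈-upTo⁻ y∈

∈-range1⁺ : ∀ {n x} → 1 ≤ x → x ≤ n → x ∈ range1 n
∈-range1⁺ {n} {suc y} _ y<n = ∈-map⁺ suc (∈-upTo⁺ y<n)

∈-words⁻ : ∀ n m w → w ∈ words n m → length w ≡ m × (∀ c → c < length w → 1 ≤ nth w c × nth w c ≤ n)
∈-words⁻ n zero .[] (here refl) = refl , λ c ()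
∈-words⁻ n (suc m) w mem with find (∈-concatMap⁻ (λ x → map (x ∷_) (words n m)) {xs = range1 n} mem)
... | x , x∈ , w∈ with ∈-map⁻ (x ∷_) w∈
... | w' , w'∈ , refl with ∈-words⁻ n m w' w'∈
... | lw , ent' = cong suc lw , λ { zero _ → ∈-range1⁻ x∈ ; (suc c) (s<s c<) → ent' c c< }

∈-fillings⁻ : ∀ n γ τ → τ ∈ fillings n γ → length τ ≡ length γ × (∀ i → rowLength τ i ≡ nth γ i) ×
  (∀ i c → i < length τ → c < rowLength τ i → 1 ≤ cell τ i c × cell τ i c ≤ n)
∈-fillings⁻ n [] .[] (here refl) = refl , (λ i → refl) , λ i c ()
∈-fillings⁻ n (r ∷ rs) τ mem with find (∈-concatMap⁻ (λ w → map (w ∷_) (fillings n rs)) {xs = words n r} mem)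
... | w , w∈ , τ∈ with ∈-map⁻ (w ∷_) τ∈
... | τ' , τ'∈ , refl with ∈-fillings⁻ n rs τ' τ'∈ | ∈-words⁻ n r w w∈
... | lτ , lens , ents | lw , entw = cong suc lτ , (λ { zero → lw ; (suc i) → lens i }) ,
      λ { zero c _ c< → entw c c< ; (suc i) c (s<s i<) c< → ents i c i< c< }

vecEqᵇ⇒≡ : ∀ {n} (u v : Vec ℕ n) → T (vecEqᵇ u v) → u ≡ v
vecEqᵇ⇒≡ [] [] _ = refl
vecEqᵇ⇒≡ (x ∷ u) (y ∷ v) t = cong₂ _∷_ (≡ᵇ⇒≡ x y (T∧₁ t)) (vecEqᵇ⇒≡ u v (T∧₂ {x ≡ᵇ y} t))

vecEqᵇ-refl : ∀ {n} (v : Vec ℕ n) → T (vecEqᵇ v v)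
vecEqᵇ-refl [] = _
vecEqᵇ-refl (x ∷ v) = T∧ (≡⇒≡ᵇ x x refl) (vecEqᵇ-refl v)

≢0⇒positive : ∀ k → + k ≢ + 0 → 0 < k
≢0⇒positive zero ne = ⊥-elim (ne refl)
≢0⇒positive (suc k) _ = z<s

qsSchur≢0⇒tableau : ∀ n γ e → qsSchur n γ e ≢ + 0 → Σ (List (List ℕ)) λ τ
  → τ ∈ fillings n γ × T (isCT τ) × content n τ ≡ e
qsSchur≢0⇒tableau n γ e ne with filterᵇ-nonempty (λ τ → isCT τ ∧ vecEqᵇ (content n τ) e) (fillings n γ) (≢0⇒positive _ ne)
... | τ , mem , t = τ , mem , T∧₁ t , vecEqᵇ⇒≡ _ _ (T∧₂ {isCT τ} t)

schur≢0⇒tableau : ∀ n γ e → schur n γ e ≢ + 0 → Σ (List (List ℕ)) λ τ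
  → τ ∈ fillings n γ × T (isSSYT τ) × content n τ ≡ e
schur≢0⇒tableau n γ e ne with filterᵇ-nonempty (λ τ → isSSYT τ ∧ vecEqᵇ (content n τ) e) (fillings n γ) (≢0⇒positive _ ne)
... | τ , mem , t = τ , mem , T∧₁ t , vecEqᵇ⇒≡ _ _ (T∧₂ {isSSYT τ} t)

sumℤ≢0⇒term : ∀ {A : Set} (h : A → ℤ) (L : List A) → sumℤ (map h L) ≢ + 0 → Σ A λ x → x ∈ L × h x ≢ + 0
sumℤ≢0⇒term h [] ne = ⊥-elim (ne refl)
sumℤ≢0⇒term h (x ∷ L) ne with h x ℤP.≟ + 0
... | no hx = x , here refl , hx
... | yes hx with sumℤ≢0⇒term h L (λ e → ne (cong₂ _+ℤ_ hx e))
... | y , y∈ , hy = y , there y∈ , hy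

∈-below⇒≤ : ∀ {n} (e a : Vec ℕ n) → a ∈ below e → ∀ v → vecAt a v ≤ vecAt e v
∈-below⇒≤ [] [] _ v = z≤n
∈-below⇒≤ (x ∷ e) (y ∷ a) mem v with find (∈-concatMap⁻ (λ b → map (b ∷_) (below e)) {xs = upTo (suc x)} mem)
... | b , b∈ , a∈ with ∈-map⁻ (b ∷_) a∈
... | a' , a'∈ , refl with v
... | zero = ≤-pred (∈-upTo⁻ b∈)
... | suc v' = ∈-below⇒≤ e a' a'∈ v'

vecAt-vsub : ∀ {n} (e a : Vec ℕ n) v → vecAt (vsub e a) v ≡ vecAt e v ∸ vecAt a v
vecAt-vsub [] [] v = refl
vecAt-vsub (x ∷ e) (y ∷ a) zero = refl
vecAt-vsub (x ∷ e) (y ∷ a) (suc v) = vecAt-vsub e a v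

*ℤ≢0⇒factors : ∀ x y → x *ℤ y ≢ + 0 → x ≢ + 0 × y ≢ + 0
*ℤ≢0⇒factors x y ne = (λ e → ne (trans (cong (_*ℤ y) e) (ℤP.*-zeroˡ y))) ,
  (λ e → ne (trans (cong (x *ℤ_) e) (ℤP.*-zeroʳ x)))

⋆≢0⇒factors : ∀ n (f g : Poly n) e → (f ⋆ g) e ≢ + 0 →
  Σ (Vec ℕ n) λ a → (∀ v → vecAt e v ≡ vecAt a v + vecAt (vsub e a) v) × f a ≢ + 0 × g (vsub e a) ≢ + 0
⋆≢0⇒factors n f g e ne with sumℤ≢0⇒term (λ a → f a *ℤ g (vsub e a)) (below e) ne
... | a , a∈ , nz = a ,
  (λ v → trans (sym (m+[n∸m]≡n (∈-below⇒≤ e a a∈ v))) (cong (λ z → vecAt a v + z) (sym (vecAt-vsub e a v)))) , *ℤ≢0⇒factors _ _ nz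

IsPartition-antitone : ∀ {lam} → IsPartition lam → ∀ i j → i ≤ j → nth lam j ≤ nth lam i
IsPartition-antitone [] i j _ = z≤n
IsPartition-antitone [ _ ] zero zero _ = ≤-refl
IsPartition-antitone [ _ ] zero (suc j) _ = z≤n
IsPartition-antitone [ _ ] (suc i) (suc j) _ = z≤n
IsPartition-antitone (_∷_ {x} {y} {ys} y≤x p) zero zero _ = ≤-refl
IsPartition-antitone (_∷_ {x} {y} {ys} y≤x p) zero (suc j) _ = ≤-trans (IsPartition-antitone p 0 j z≤n) y≤x
IsPartition-antitone (_∷_ {x} {y} {ys} y≤x p) (suc i) (suc j) (s≤s le) = IsPartition-antitone p i j le

padTo : List ℕ → (n : ℕ) → Vec ℕ n
padTo γ n = tabulate (λ i → nth γ (toℕ i))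

TopBounded : (n : ℕ) → Vec ℕ n → List ℕ → Set

TopBounded n e γ = ∀ k (p : ℕ → Bool) → ∑[ v < n ] 𝟙 (p v) ≤ k → ∑[ v < n ] (𝟙 (p v) * vecAt e v) ≤ top k γ

qsSchur-TopBounded : ∀ n γ e → qsSchur n γ e ≢ + 0 → TopBounded n e γ
qsSchur-TopBounded n γ e ne k p pk with qsSchur≢0⇒tableau n γ e ne
... | τ , mem , ct , refl with ∈-fillings⁻ n γ τ mem
... | lτ , lens , ents = subst (_ ≤_) (sym (top≡layers-nth k γ))
      (content≤layers n τ γ k p (CompositionTableau.distinctColumns τ ct) lτ lens ents pk)

schur-TopBounded : ∀ n lam e → IsPartition lam → schur n lam e ≢ + 0 → TopBounded n e lam
schur-TopBounded n lam e part ne k p pk with schur≢0⇒tableau n lam e ne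
... | τ , mem , ss , refl with ∈-fillings⁻ n lam τ mem
... | lτ , lens , ents = subst (_ ≤_) (sym (top≡layers-nth k lam))
      (content≤layers n τ lam k p (SemistandardTableau.distinctColumns τ ss mono) lτ lens ents pk)
  where
  mono : ∀ i j → i ≤ j → j < length τ → rowLength τ j ≤ rowLength τ i
  mono i j le _ = subst₂ _≤_ (sym (lens j)) (sym (lens i)) (IsPartition-antitone part i j le)

product-TopBounded : ∀ n lam β e → IsPartition lam → (schur n lam ⋆ qsSchur n β) e ≢ + 0 → TopBounded n e (phi lam β)
product-TopBounded n lam β e part ne k p pk with ⋆≢0⇒factors n (schur n lam) (qsSchur n β) e ne
... | a , split , nza , nzb = begin
  ∑[ v < n ] (𝟙 (p v) * vecAt e v)
    ≡⟨ ∑<-cong n (λ v _ → trans (cong (𝟙 (p v) *_) (split v)) (*-distribˡ-+ (𝟙 (p v)) _ _)) ⟩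
  ∑[ v < n ] (𝟙 (p v) * vecAt a v + 𝟙 (p v) * vecAt (vsub e a) v) ≡⟨ ∑<-distrib-+ n _ _ ⟩
  ∑[ v < n ] (𝟙 (p v) * vecAt a v) + ∑[ v < n ] (𝟙 (p v) * vecAt (vsub e a) v)
    ≤⟨ +-mono-≤ (schur-TopBounded n lam a part nza k p pk) (qsSchur-TopBounded n β (vsub e a) nzb k p pk) ⟩
  top k lam + top k β ≤⟨ top-phi k lam β part ⟩
  top k (phi lam β) ∎
  where open ≤-Reasoning

top-attained-padTo : ∀ n γ k → length γ ≤ n → Σ (ℕ → Bool) λ p
  → ∑[ v < n ] 𝟙 (p v) ≤ k × top k γ ≤ ∑[ v < n ] (𝟙 (p v) * vecAt (padTo γ n) v)
top-attained-padTo n γ k le = (λ v → rank n (nth γ) v <ᵇ k) ,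
  ≤-trans (≤-reflexive (∑<-rank< n (nth γ) k)) (m⊓n≤m k n) ,
  (begin
    top k γ ≡⟨ top≡layers k γ n (sum γ) le ≤-refl ⟩
    layers n (sum γ) k (nth γ) ≤⟨ layers≤topRankedSum n (sum γ) k (nth γ) (λ i _ → nth≤sum γ i) ⟩
    ∑[ j < n ] (𝟙 (rank n (nth γ) j <ᵇ k) * nth γ j)
      ≡⟨ ∑<-cong n (λ v v<n → cong (𝟙 (rank n (nth γ) v <ᵇ k) *_) (sym (vecAt-tabulate n (nth γ) v v<n))) ⟩
    ∑[ v < n ] (𝟙 (rank n (nth γ) v <ᵇ k) * vecAt (padTo γ n) v) ∎)
  where open ≤-Reasoning

qsSchur-padTo-dominated : ∀ n g z → length g ≤ n → qsSchur n z (padTo g n) ≢ + 0 → ∀ k → top k g ≤ top k z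
qsSchur-padTo-dominated n g z ℓg≤n S≢0 k with top-attained-padTo n g k ℓg≤n
... | S , |S|≤k , g≤S = ≤-trans g≤S (qsSchur-TopBounded n z (padTo g n) S≢0 k S |S|≤k)

superstandard : ℕ → List ℕ → List (List ℕ)
superstandard s [] = []
superstandard s (g ∷ γ) = replicate g (suc s) ∷ superstandard (suc s) γ

replicate∈words : ∀ n g v → 1 ≤ v → v ≤ n → replicate g v ∈ words n g
replicate∈words n zero v _ _ = here refl
replicate∈words n (suc g) v 1v vn = ∈-concatMap⁺ (λ x → map (x ∷_) (words n g))
  (Any.map (λ { refl → ∈-map⁺ (v ∷_) (replicate∈words n g v 1v vn) }) (∈-range1⁺ 1v vn))

superstandard∈fillings : ∀ n s γ → s + length γ ≤ n → superstandard s γ ∈ fillings n γ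
superstandard∈fillings n s [] _ = here refl
superstandard∈fillings n s (g ∷ γ) le = ∈-concatMap⁺ (λ w → map (w ∷_) (fillings n γ))
  (Any.map (λ { refl → ∈-map⁺ (replicate g (suc s) ∷_) (superstandard∈fillings n (suc s) γ le′) })
    (replicate∈words n g (suc s) (s≤s z≤n) (≤-trans (s≤s (m≤m+n s _)) le′)))
  where
  le′ : suc s + length γ ≤ n
  le′ = ≤-trans (≤-reflexive (sym (+-suc s _))) le

nthRow-superstandard : ∀ s γ a → nthRow (superstandard s γ) a ≡ replicate (nth γ a) (suc (s + a))
nthRow-superstandard s [] a = refl
nthRow-superstandard s (g ∷ γ) zero = cong (λ z → replicate g (suc z)) (sym (+-identityʳ s))
nthRow-superstandard s (g ∷ γ) (suc a) = trans (nthRow-superstandard (suc s) γ a)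
  (cong (λ z → replicate (nth γ a) (suc z)) (sym (+-suc s a)))

nth-replicate : ∀ g v c → c < g → nth (replicate g v) c ≡ v
nth-replicate (suc g) v zero _ = refl
nth-replicate (suc g) v (suc c) (s<s c<g) = nth-replicate g v c c<g

length-superstandard : ∀ s γ → length (superstandard s γ) ≡ length γ
length-superstandard s [] = refl
length-superstandard s (g ∷ γ) = cong suc (length-superstandard (suc s) γ)

rowLength-superstandard : ∀ γ a → rowLength (superstandard 0 γ) a ≡ nth γ a
rowLength-superstandard γ a = trans (cong length (nthRow-superstandard 0 γ a)) (length-replicate (nth γ a))

cell-superstandard : ∀ γ a c → c < nth γ a → cell (superstandard 0 γ) a c ≡ suc a
cell-superstandard γ a c c< = trans (cong (λ r → nth r c) (nthRow-superstandard 0 γ a))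
  (nth-replicate (nth γ a) (suc a) c c<)

superstandard-isCT : ∀ γ → All (λ x → 0 < x) γ → T (isCT (superstandard 0 γ))
superstandard-isCT γ posγ = T∧ rows-decrease (T∧ firstColumn-increases triples)
  where
  τ : List (List ℕ)
  τ = superstandard 0 γ
  ℓ : ℕ
  ℓ = length τ
  posn : ∀ a → a < ℓ → 0 < nth γ a
  posn a a<ℓ = nth-positive γ posγ a (subst (a <_) (length-superstandard 0 γ) a<ℓ)
  rows-decrease : T (ct1ᵇ τ)
  rows-decrease = allᵇ-range1⁺ _ ℓ (λ a a<ℓ → allᵇ-range1⁺ _ _ (λ c c< → ≤⇒≤ᵇ (≤-reflexive (
    let sc< : suc c < nth γ a
        sc< = subst (suc c <_) (rowLength-superstandard γ a) (<∸1⇒suc< (rowLength τ a) c<)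
    in trans (cell-superstandard γ a (suc c) sc<) (sym (cell-superstandard γ a c (<-trans (n<1+n c) sc<)))))))
    where
    <∸1⇒suc< : ∀ L {c} → c < L ∸ 1 → suc c < L
    <∸1⇒suc< (suc L) lt = s<s lt
  firstColumn-increases : T (ct2ᵇ τ)
  firstColumn-increases = allᵇ-range1⁺ _ ℓ (λ a a<ℓ → allᵇ-range1⁺ _ ℓ (λ b b<ℓ → T⇒ᵇ (λ ab →
    subst₂ (λ x y → T (x <ᵇ y)) (sym (cell-superstandard γ a 0 (posn a a<ℓ))) (sym (cell-superstandard γ b 0 (posn b b<ℓ))) ab)))
  triples : T (ct3ᵇ τ)
  triples = allᵇ-range1⁺ _ ℓ (λ a a<ℓ → allᵇ-range1⁺ _ ℓ (λ b b<ℓ → T⇒ᵇ (λ ab → allᵇ-range1⁺ _ _ (λ c c< →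
    let ca : c < nth γ a
        ca = subst (c <_) (rowLength-superstandard γ a) (<-≤-trans c< (m⊓n≤m _ _))
        cb : c < nth γ b
        cb = subst (c <_) (rowLength-superstandard γ b) (<-≤-trans c< (m⊓n≤n _ _))
        sa<sb : suc a < suc b
        sa<sb = <ᵇ⇒< (suc a) (suc b) ab
    in T∧ (T⇒ᵇ {rowLength τ b ≤ᵇ rowLength τ a} (λ _ → ∨T₂ {cell τ b c <ᵇ cell τ a c} (first c ca sa<sb cb)))
          (T⇒ᵇ {rowLength τ a <ᵇ rowLength τ b} (λ lt → ∨T₂ {cell τ b c <ᵇ cell τ a c} (subst₂ (λ x y → T (x <ᵇ y)) (sym (cell-superstandard γ a c ca))
             (sym (cell-superstandard γ b (suc c) (<-≤-trans (s≤s ca) (subst₂ _≤_ (cong suc (rowLength-superstandard γ a)) (rowLength-superstandard γ b) (<ᵇ⇒< _ _ lt)))))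
             (<⇒<ᵇ sa<sb))))))))
    where
    first : ∀ {a b} c → c < nth γ a → suc a < suc b → c < nth γ b → T (entry τ (suc a) c <ᵇ cell τ b c)
    first {a} {b} zero ca sa<sb cb = subst (λ y → T (0 <ᵇ y)) (sym (cell-superstandard γ b 0 cb)) _
    first {a} {b} (suc c) ca sa<sb cb = subst₂ (λ x y → T (x <ᵇ y))
      (sym (cell-superstandard γ a c (<-trans (n<1+n c) ca))) (sym (cell-superstandard γ b (suc c) cb)) (<⇒<ᵇ sa<sb)

countᵇ-replicate : ∀ (p : ℕ → Bool) g v → countᵇ p (replicate g v) ≡ g * 𝟙 (p v)
countᵇ-replicate p zero v = refl
countᵇ-replicate p (suc g) v with p v in e
... | true = cong suc (trans (countᵇ-replicate p g v) (cong (λ b → g * 𝟙 b) e))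
... | false = trans (countᵇ-replicate p g v) (cong (λ b → g * 𝟙 b) e)

countᵇ-superstandard-below : ∀ s γ w → w ≤ s → countᵇ (λ x → x ≡ᵇ w) (concat (superstandard s γ)) ≡ 0
countᵇ-superstandard-below s [] w _ = refl
countᵇ-superstandard-below s (g ∷ γ) w w≤s = trans (countᵇ-++ _ (replicate g (suc s)) _)
  (cong₂ _+_ (trans (countᵇ-replicate _ g (suc s)) (trans (cong (λ b → g * 𝟙 b) (differ w w≤s)) (*-zeroʳ g)))
             (countᵇ-superstandard-below (suc s) γ w (≤-trans w≤s (n≤1+n s))))
  where
  differ : ∀ w → w ≤ s → (suc s ≡ᵇ w) ≡ false
  differ w w≤s with suc s ≡ᵇ w in e
  ... | false = refl
  ... | true = ⊥-elim (<-irrefl (sym (≡ᵇ⇒≡ (suc s) w (subst T (sym e) _))) (s≤s w≤s))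

countᵇ-superstandard : ∀ s γ i → countᵇ (λ x → x ≡ᵇ suc (s + i)) (concat (superstandard s γ)) ≡ nth γ i
countᵇ-superstandard s [] i = refl
countᵇ-superstandard s (g ∷ γ) zero = trans (countᵇ-++ _ (replicate g (suc s)) _)
  (trans (cong₂ _+_ (trans (countᵇ-replicate _ g (suc s)) (trans (cong (λ b → g * 𝟙 b) (same-letter s)) (*-identityʳ g)))
             (countᵇ-superstandard-below (suc s) γ (suc (s + 0)) (s≤s (≤-reflexive (+-identityʳ s)))))
     (+-identityʳ g))
  where
  same-letter : ∀ s → (suc s ≡ᵇ suc (s + 0)) ≡ true
  same-letter zero = refl
  same-letter (suc s) = same-letter s
countᵇ-superstandard s (g ∷ γ) (suc i) = trans (countᵇ-++ _ (replicate g (suc s)) _)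
  (cong₂ _+_ (trans (countᵇ-replicate _ g (suc s)) (trans (cong (λ b → g * 𝟙 b) (other-letter s i)) (*-zeroʳ g)))
             (trans (cong (λ z → countᵇ (λ x → x ≡ᵇ suc z) (concat (superstandard (suc s) γ))) (+-suc s i)) (countᵇ-superstandard (suc s) γ i)))
  where
  other-letter : ∀ s i → (suc s ≡ᵇ suc (s + suc i)) ≡ false
  other-letter zero i = refl
  other-letter (suc s) i = other-letter s i

content-superstandard : ∀ n γ → content n (superstandard 0 γ) ≡ padTo γ n
content-superstandard n γ = tabulate-cong (λ i → countᵇ-superstandard 0 γ (toℕ i))

qsSchur-padTo-positive : ∀ n γ → All (λ x → 0 < x) γ → length γ ≤ n → Σ ℕ λ q → qsSchur n γ (padTo γ n) ≡ + suc q
qsSchur-padTo-positive n γ posγ le with length (filterᵇ (λ τ → isCT τ ∧ vecEqᵇ (content n τ) (padTo γ n)) (fillings n γ))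
  | ∈⇒filterᵇ-nonempty (λ τ → isCT τ ∧ vecEqᵇ (content n τ) (padTo γ n)) (fillings n γ) (superstandard 0 γ) (superstandard∈fillings n 0 γ le)
      (T∧ (superstandard-isCT γ posγ) (subst (λ z → T (vecEqᵇ z (padTo γ n))) (sym (content-superstandard n γ)) (vecEqᵇ-refl (padTo γ n))))
... | suc q | _ = q , refl

suffixSum : ℕ → ℕ → (ℕ → ℕ) → ℕ
suffixSum m v f = ∑[ i < m ] (𝟙 (v ≤ᵇ i) * f i)

𝟙-<ᵇ-suc : ∀ v i → 𝟙 (v <ᵇ suc i) ≡ 𝟙 (v ≡ᵇ i) + 𝟙 (v <ᵇ i)
𝟙-<ᵇ-suc zero zero = refl
𝟙-<ᵇ-suc zero (suc i) = refl
𝟙-<ᵇ-suc (suc v) zero = refl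
𝟙-<ᵇ-suc (suc v) (suc i) = 𝟙-<ᵇ-suc v i

𝟙-≤ᵇ : ∀ v i → 𝟙 (v ≤ᵇ i) ≡ 𝟙 (v ≡ᵇ i) + 𝟙 (v <ᵇ i)
𝟙-≤ᵇ zero i = 𝟙-<ᵇ-suc zero i
𝟙-≤ᵇ (suc v) i = 𝟙-<ᵇ-suc (suc v) i

suffixSum-step : ∀ n v f → v < n → suffixSum n v f ≡ f v + suffixSum n (suc v) f
suffixSum-step n v f v<n = begin
  ∑[ i < n ] (𝟙 (v ≤ᵇ i) * f i)
    ≡⟨ ∑<-cong n (λ i _ → trans (cong (_* f i) (𝟙-≤ᵇ v i)) (*-distribʳ-+ (f i) (𝟙 (v ≡ᵇ i)) _)) ⟩
  ∑[ i < n ] (𝟙 (v ≡ᵇ i) * f i + 𝟙 (v <ᵇ i) * f i) ≡⟨ ∑<-distrib-+ n _ _ ⟩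
  ∑[ i < n ] (𝟙 (v ≡ᵇ i) * f i) + ∑[ i < n ] (𝟙 (v <ᵇ i) * f i)
    ≡⟨ cong (_+ ∑[ i < n ] (𝟙 (v <ᵇ i) * f i)) (∑<-point n v f v<n) ⟩
  f v + suffixSum n (suc v) f ∎
  where open ≡-Reasoning

suffixSum-extend : ∀ x n v → length x ≤ n → suffixSum (length x) v (nth x) ≡ suffixSum n v (nth x)
suffixSum-extend x n v le = sym
  (∑<-extend (length x) n le (λ i li → trans (cong (𝟙 (v ≤ᵇ i) *_) (nth-beyond x i li)) (*-zeroʳ (𝟙 (v ≤ᵇ i)))))

nth-ext : ∀ (x y : List ℕ) → length x ≡ length y → (∀ i → i < length x → nth x i ≡ nth y i) → x ≡ y
nth-ext [] [] _ _ = refl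
nth-ext (a ∷ x) (b ∷ y) le h = cong₂ _∷_ (h 0 z<s) (nth-ext x y (suc-injective le) (λ i i< → h (suc i) (s<s i<)))

-- A composition tableau whose content is γ₀ (padded) uses only the letters 1, …, ℓ(γ₀) = ℓ(γ), so its
-- strictly increasing first column starts row a with at most a + 1; as rows weakly decrease, row a
-- uses only letters ≤ a + 1, which bounds the suffix sums of γ₀ by those of the shape γ.
module TableauOfPaddedContent (n : ℕ) (γ γ₀ : List ℕ) (posγ : All (λ x → 0 < x) γ) (ℓeq : length γ ≡ length γ₀)
  (τ : List (List ℕ)) (mem : τ ∈ fillings n γ) (ct : T (isCT τ))
  (cont : content n τ ≡ padTo γ₀ n) where
  open CompositionTableau τ ct using (ct1; ct2)
  lτ : length τ ≡ length γ
  lτ = proj₁ (∈-fillings⁻ n γ τ mem)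
  lens : ∀ i → rowLength τ i ≡ nth γ i
  lens = proj₁ (proj₂ (∈-fillings⁻ n γ τ mem))
  ents : ∀ i c → i < length τ → c < rowLength τ i → 1 ≤ cell τ i c × cell τ i c ≤ n
  ents = proj₂ (proj₂ (∈-fillings⁻ n γ τ mem))
  ℓ : ℕ
  ℓ = length τ
  ℓ≡ : ℓ ≡ length γ₀
  ℓ≡ = trans lτ ℓeq

  letter-occurs : ∀ a c → a < ℓ → c < rowLength τ a → 1 ≤ ∑cells (λ x → 𝟙 (x ≡ᵇ cell τ a c)) τ
  letter-occurs a c a<ℓ c< = ≤-trans (≤-reflexive (sym (𝟙-T _ (≡⇒≡ᵇ (cell τ a c) _ refl))))
    (≤-trans (∑<-term (rowLength τ a) (λ c' → 𝟙 (cell τ a c' ≡ᵇ cell τ a c)) c c<)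
      (∑<-term ℓ (λ i → ∑[ c' < (rowLength τ i) ] 𝟙 (cell τ i c' ≡ᵇ cell τ a c)) a a<ℓ))

  cell≤length : ∀ a c → a < ℓ → c < rowLength τ a → cell τ a c ≤ ℓ
  cell≤length a c a<ℓ c< with cell τ a c in ex | ents a c a<ℓ c<
  ... | suc y | _ , sy≤n = subst (suc y ≤_) (sym ℓ≡) y<
    where
    y<n : y < n
    y<n = sy≤n
    pos : 1 ≤ nth γ₀ y
    pos = begin
      1 ≤⟨ subst (λ z → 1 ≤ ∑cells (λ x → 𝟙 (x ≡ᵇ z)) τ) ex (letter-occurs a c a<ℓ c<) ⟩
      ∑cells (λ x → 𝟙 (x ≡ᵇ suc y)) τ ≡⟨ sym (vecAt-content n τ y y<n) ⟩
      vecAt (content n τ) y ≡⟨ cong (λ z → vecAt z y) cont ⟩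
      vecAt (padTo γ₀ n) y ≡⟨ vecAt-tabulate n (nth γ₀) y y<n ⟩
      nth γ₀ y ∎
      where open ≤-Reasoning
    y< : y < length γ₀
    y< with y <? length γ₀
    ... | yes p = p
    ... | no np = ⊥-elim (<-irrefl (sym (nth-beyond γ₀ y (≮⇒≥ np))) pos)

  firstColumn-gap : ∀ d a → a + d < ℓ → cell τ a 0 + d ≤ cell τ (a + d) 0
  firstColumn-gap zero a lt = ≤-reflexive (trans (+-identityʳ _) (cong (λ z → cell τ z 0) (sym (+-identityʳ a))))
  firstColumn-gap (suc d) a lt = begin
    cell τ a 0 + suc d ≡⟨ +-suc _ d ⟩
    suc (cell τ a 0 + d) ≤⟨ s≤s (firstColumn-gap d a (<-trans (+-monoʳ-< a (n<1+n d)) lt)) ⟩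
    suc (cell τ (a + d) 0) ≤⟨ ct2 (a + d) (a + suc d) (+-monoʳ-< a (n<1+n d)) lt ⟩
    cell τ (a + suc d) 0 ∎
    where open ≤-Reasoning

  rowLength-positive : ∀ a → a < ℓ → 0 < rowLength τ a
  rowLength-positive a a<ℓ = subst (0 <_) (sym (lens a)) (nth-positive γ posγ a (subst (a <_) lτ a<ℓ))

  firstColumn≤ : ∀ a → a < ℓ → cell τ a 0 ≤ suc a
  firstColumn≤ a a<ℓ = +-cancelʳ-≤ d (cell τ a 0) (suc a) (begin
    cell τ a 0 + d ≤⟨ firstColumn-gap d a last< ⟩
    cell τ (a + d) 0 ≤⟨ cell≤length (a + d) 0 last< (rowLength-positive (a + d) last<) ⟩
    ℓ ≡⟨ sym (m+[n∸m]≡n a<ℓ) ⟩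
    suc a + d ∎)
    where
    open ≤-Reasoning
    d = ℓ ∸ suc a
    last< : a + d < ℓ
    last< = ≤-reflexive (m+[n∸m]≡n a<ℓ)

  cell≤firstColumn : ∀ a c → a < ℓ → c < rowLength τ a → cell τ a c ≤ cell τ a 0
  cell≤firstColumn a zero _ _ = ≤-refl
  cell≤firstColumn a (suc c) a<ℓ c< = ≤-trans (ct1 a c a<ℓ c<) (cell≤firstColumn a c a<ℓ (<-trans (n<1+n c) c<))

  cell≤rowIndex : ∀ a c → a < ℓ → c < rowLength τ a → cell τ a c ≤ suc a
  cell≤rowIndex a c a<ℓ c< = ≤-trans (cell≤firstColumn a c a<ℓ c<) (firstColumn≤ a a<ℓ)

  rowCount-suffix : ∀ v a → a < ℓ
    → ∑[ c < (rowLength τ a) ] 𝟙 (letterIn n (v ≤ᵇ_) (cell τ a c)) ≤ 𝟙 (v ≤ᵇ a) * rowLength τ a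
  rowCount-suffix v a a<ℓ with v ≤ᵇ a in e
  ... | true = ≤-trans (∑<-≤1 (rowLength τ a) (λ c _ → 𝟙≤1 _)) (≤-reflexive (sym (+-identityʳ _)))
  ... | false = ≤-reflexive (∑<-zero (rowLength τ a) (λ c c< → lem c c<))
    where
    a<v : a < v
    a<v with a <? v
    ... | yes p = p
    ... | no np = ⊥-elim (subst T e (≤⇒≤ᵇ (≮⇒≥ np)))
    lem : ∀ c → c < rowLength τ a → 𝟙 (letterIn n (v ≤ᵇ_) (cell τ a c)) ≡ 0
    lem c c< with cell τ a c in ex
    ... | zero = refl
    ... | suc y with v ≤ᵇ y in e2
    ...   | false = cong 𝟙 (∧-zeroʳ (y <ᵇ n))
    ...   | true = ⊥-elim (<-irrefl refl (≤-<-trans (≤ᵇ⇒≤ v y (subst T (sym e2) _))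
                       (≤-<-trans (≤-pred (subst (_≤ suc a) ex (cell≤rowIndex a c a<ℓ c<))) a<v)))

  suffixSum≤ : ∀ v → suffixSum n v (nth γ₀) ≤ suffixSum (length γ) v (nth γ)
  suffixSum≤ v = begin
    ∑[ u < n ] (𝟙 (v ≤ᵇ u) * nth γ₀ u) ≡⟨ ∑<-cong n (λ u u<n → cong (𝟙 (v ≤ᵇ u) *_)
          (trans (sym (vecAt-tabulate n (nth γ₀) u u<n)) (trans (cong (λ z → vecAt z u) (sym cont)) (vecAt-content n τ u u<n)))) ⟩
    ∑[ u < n ] (𝟙 (v ≤ᵇ u) * ∑cells (λ x → 𝟙 (x ≡ᵇ suc u)) τ) ≡⟨ ∑<-cong n (λ u _ → trans (∑<-*-distribˡ ℓ (𝟙 (v ≤ᵇ u)) _)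
          (∑<-cong ℓ (λ i _ → ∑<-*-distribˡ (rowLength τ i) (𝟙 (v ≤ᵇ u)) _))) ⟩
    ∑[ u < n ] (∑cells (λ x → 𝟙 (v ≤ᵇ u) * 𝟙 (x ≡ᵇ suc u)) τ)
      ≡⟨ ∑<-∑cells n (λ u x → 𝟙 (v ≤ᵇ u) * 𝟙 (x ≡ᵇ suc u)) τ ⟩
    ∑cells (λ x → ∑[ u < n ] (𝟙 (v ≤ᵇ u) * 𝟙 (x ≡ᵇ suc u))) τ
      ≡⟨ ∑<-cong ℓ (λ i _ → ∑<-cong (rowLength τ i) (λ c _ → ∑<-letterIn n (v ≤ᵇ_) (cell τ i c))) ⟩
    ∑cells (λ x → 𝟙 (letterIn n (v ≤ᵇ_) x)) τ ≤⟨ ∑<-mono-≤ ℓ (λ a a<ℓ → rowCount-suffix v a a<ℓ) ⟩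
    ∑[ a < ℓ ] (𝟙 (v ≤ᵇ a) * rowLength τ a) ≡⟨ trans (cong (λ z → ∑[ a < z ] (𝟙 (v ≤ᵇ a) * rowLength τ a)) lτ)
          (∑<-cong (length γ) (λ a _ → cong (𝟙 (v ≤ᵇ a) *_) (lens a))) ⟩
    ∑[ a < (length γ) ] (𝟙 (v ≤ᵇ a) * nth γ a) ∎
    where open ≤-Reasoning

∈-words⁺ : ∀ d (w : List ℕ) → All (λ x → 1 ≤ x × x ≤ d) w → w ∈ words d (length w)
∈-words⁺ d [] [] = here refl
∈-words⁺ d (x ∷ w) ((1x , xd) ∷ ps) = ∈-concatMap⁺ (λ y → map (y ∷_) (words d (length w)))
  (Any.map (λ { refl → ∈-map⁺ (x ∷_) (∈-words⁺ d w ps) }) (∈-range1⁺ 1x xd))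

All-bounded-by-sum : ∀ (α : List ℕ) → All (λ x → 0 < x) α → All (λ x → 1 ≤ x × x ≤ sum α) α
All-bounded-by-sum [] [] = []
All-bounded-by-sum (x ∷ α) (p ∷ ps) = (p , m≤m+n x _) ∷ weaken (All-bounded-by-sum α ps)
  where
  weaken : ∀ {l} → All (λ y → 1 ≤ y × y ≤ sum α) l → All (λ y → 1 ≤ y × y ≤ x + sum α) l
  weaken [] = []
  weaken ((a , b) ∷ qs) = (a , ≤-trans b (m≤n+m _ x)) ∷ weaken qs

∈-compositions⁺ : ∀ n d α → All (λ x → 0 < x) α → sum α ≡ d → length α ≤ n → α ∈ compositions n d
∈-compositions⁺ n d α pos sα lα = ∈-filter⁺ (λ γ → T? (sum γ ≡ᵇ d))
  (∈-concatMap⁺ (words d) (Any.map (λ { refl → wα }) (∈-upTo⁺ (s≤s lα))))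
  (≡⇒≡ᵇ (sum α) d sα)
  where
  wα : α ∈ words d (length α)
  wα = ∈-words⁺ d α (subst (λ s → All (λ x → 1 ≤ x × x ≤ s) α) sα (All-bounded-by-sum α pos))

nth⇒All : ∀ {P : ℕ → Set} (w : List ℕ) → (∀ c → c < length w → P (nth w c)) → All P w
nth⇒All [] h = []
nth⇒All (x ∷ w) h = h 0 z<s ∷ nth⇒All w (λ c c< → h (suc c) (s<s c<))

∈-compositions⁻ : ∀ n d γ → γ ∈ compositions n d → All (λ x → 0 < x) γ × length γ ≤ n × sum γ ≡ d
∈-compositions⁻ n d γ mem with ∈-filter⁻ (λ γ → T? (sum γ ≡ᵇ d)) mem
... | m , t with find (∈-concatMap⁻ (words d) {xs = upTo (suc n)} m)
... | k , k∈ , w∈ with ∈-words⁻ d k γ w∈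
... | lw , ents = nth⇒All γ (λ c c< → proj₁ (ents c c<)) , ≤-pred (subst (_< suc n) (sym lw) (∈-upTo⁻ k∈)) , ≡ᵇ⇒≡ _ _ t

*ℤ-≢0 : ∀ x y → x ≢ + 0 → y ≢ + 0 → x *ℤ y ≢ + 0
*ℤ-≢0 x y nx ny e with ℤP.i*j≡0⇒i≡0∨j≡0 x e
... | inj₁ p = nx p
... | inj₂ p = ny p

sumℤ-single : ∀ {A : Set} (h : A → ℤ) (L : List A) x₀ → h x₀ ≢ + 0 → (∀ z → z ∈ L → h z ≡ + 0 ⊎ z ≡ x₀) →
  Σ ℕ λ c → (x₀ ∈ L → 1 ≤ c) × sumℤ (map h L) ≡ + c *ℤ h x₀
sumℤ-single h [] x₀ nz H = 0 , (λ ()) , sym (ℤP.*-zeroˡ (h x₀))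
sumℤ-single h (a ∷ L) x₀ nz H with sumℤ-single h L x₀ nz (λ z m → H z (there m)) | H a (here refl)
... | c , pc , e | inj₁ ha = c , (λ { (here refl) → ⊥-elim (nz ha) ; (there m) → pc m }) , trans
  (cong₂ _+ℤ_ ha e) (ℤP.+-identityˡ _)
... | c , pc , e | inj₂ refl = suc c , (λ _ → s≤s z≤n) , trans (cong (h a +ℤ_) e)
      (trans (cong (_+ℤ (+ c *ℤ h a)) (sym (ℤP.*-identityˡ (h a)))) (sym (ℤP.*-distribʳ-+ (h a) (+ 1) (+ c))))

sumℤ-single-≢0 : ∀ {A : Set} (h : A → ℤ) (L : List A) x₀ → x₀ ∈ L → h x₀ ≢ + 0 → (∀ z → z ∈ L → h z ≡ + 0 ⊎ z ≡ x₀) →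
  sumℤ (map h L) ≢ + 0
sumℤ-single-≢0 h L x₀ mem nz H e with sumℤ-single h L x₀ nz H
... | suc c' , pc , e2 = *ℤ-≢0 (+ suc c') (h x₀) (λ ()) nz (trans (sym e2) e)
... | zero , pc , e2 with pc mem
... | ()

qsSchur-padTo-suffix : ∀ n z g → IsComposition z → length z ≡ length g → length z ≤ n →
  qsSchur n z (padTo g n) ≢ + 0 → ∀ v → suffixSum n v (nth g) ≤ suffixSum n v (nth z)
qsSchur-padTo-suffix n z g posz ℓz≡ℓg ℓz≤n S≢0 v with qsSchur≢0⇒tableau n z (padTo g n) S≢0
... | τ , τ∈ , ct , cont = begin
  suffixSum n v (nth g) ≤⟨ TableauOfPaddedContent.suffixSum≤ n z g posz ℓz≡ℓg τ τ∈ ct cont v ⟩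
  suffixSum (length z) v (nth z) ≡⟨ suffixSum-extend z n v ℓz≤n ⟩
  suffixSum n v (nth z) ∎
  where open ≤-Reasoning

equal-tops⇒length≤ : ∀ n x y → IsComposition x → sum x ≡ sum y → length y ≤ n →
  (∀ k → k < suc n → top k x ≡ top k y) → length x ≤ length y
equal-tops⇒length≤ n x y posx Σx≡Σy ℓy≤n tops = ≮⇒≥ λ y<x → <-irrefl (tops (length y) (s≤s ℓy≤n)) (begin-strict
  top (length y) x <⟨ top-<length (length y) x posx y<x ⟩
  sum x ≡⟨ Σx≡Σy ⟩
  sum y ≡⟨ sym (top-≥length (length y) y ≤-refl) ⟩
  top (length y) y ∎)
  where open ≤-Reasoning

suffixSums-injective : ∀ n x y → length x ≤ n → length x ≡ length y →
  (∀ v → v < suc n → suffixSum n v (nth x) ≡ suffixSum n v (nth y)) → x ≡ y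
suffixSums-injective n x y ℓx≤n ℓx≡ℓy suffixes = nth-ext x y ℓx≡ℓy λ i i<x → nth-equal i (<-≤-trans i<x ℓx≤n)
  where
  nth-equal : ∀ v → v < n → nth x v ≡ nth y v
  nth-equal v v<n = +-cancelʳ-≡ _ _ _ (begin
    nth x v + suffixSum n (suc v) (nth x) ≡⟨ suffixSum-step n v (nth x) v<n ⟨
    suffixSum n v (nth x) ≡⟨ suffixes v (<-trans v<n (n<1+n n)) ⟩
    suffixSum n v (nth y) ≡⟨ suffixSum-step n v (nth y) v<n ⟩
    nth y v + suffixSum n (suc v) (nth y) ≡⟨ cong (_+_ (nth y v)) (suffixes (suc v) (s<s v<n)) ⟨
    nth y v + suffixSum n (suc v) (nth x) ∎)
    where open ≡-Reasoning

∃-maximal : ∀ {A : Set} {P : A → Set} (P? : Decidable P) (key : A → ℕ) {x xs} → x ∈ xs → P x →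
  ∃ λ y → y ∈ xs × P y × (∀ {z} → z ∈ xs → P z → key z ≤ key y)
∃-maximal {A} P? key {x} {xs} x∈ px = y , y∈xs , argmax-all key px (all-filter P? xs) ,
  λ z∈ pz → All.lookup (f[xs]≤f[argmax] x (filter P? xs)) (∈-filter⁺ P? z∈ pz)
  where
  y : A
  y = argmax key x (filter P? xs)
  y∈xs : y ∈ xs
  y∈xs with argmax-sel key x (filter P? xs)
  ... | inj₁ y≡x = subst (_∈ xs) (sym y≡x) x∈
  ... | inj₂ y∈ = proj₁ (∈-filter⁻ P? y∈)

module Triangularity (n d : ℕ) (P : Poly n) (μ : List ℕ)
    (P-bounded : ∀ e → P e ≢ + 0 → TopBounded n e μ)
    (C : List ℕ → ℤ) (expansion : IsQSExpansion n d P C) where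

  -- top k γ = top (length γ) γ for k ≥ length γ, so k < K covers μ and every γ with ℓ(γ) ≤ n.
  K : ℕ
  K = suc (length μ + n)

  Exceeds : List ℕ → Set
  Exceeds γ = ∃ λ k → k < K × top k μ < top k γ

  exceeds? : Decidable Exceeds
  exceeds? γ = anyUpTo? (λ k → top k μ <? top k γ) K

  Violator : List ℕ → Set
  Violator γ = C γ ≢ + 0 × Exceeds γ

  violator? : Decidable Violator
  violator? γ = ¬? (C γ ℤP.≟ + 0) ×-dec exceeds? γ

  ¬exceeds⇒dominated : ∀ α → length α ≤ n → ¬ Exceeds α → Dominates (sortDec μ) (sortDec α)
  ¬exceeds⇒dominated α ℓα≤n ¬ex k = begin
    sum (take k (sortDec α)) ≡⟨ sum-take-sortDec≡top k α ⟩
    top k α ≡⟨ top-⊓ k α B (≤-trans ℓα≤n (m≤n+m n _)) ⟨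
    top (k ⊓ B) α ≤⟨ ≮⇒≥ (λ μ<α → ¬ex (k ⊓ B , s≤s (m⊓n≤n k B) , μ<α)) ⟩
    top (k ⊓ B) μ ≡⟨ top-⊓ k μ B (m≤m+n _ n) ⟩
    top k μ ≡⟨ sum-take-sortDec≡top k μ ⟨
    sum (take k (sortDec μ)) ∎
    where
    open ≤-Reasoning
    B : ℕ
    B = length μ + n

  P-vanishes : ∀ g → length g ≤ n → Exceeds g → P (padTo g n) ≡ + 0
  P-vanishes g ℓg≤n (k , _ , μ<g) with P (padTo g n) ℤP.≟ + 0
  ... | yes P≡0 = P≡0
  ... | no P≢0 with top-attained-padTo n g k ℓg≤n
  ...   | S , |S|≤k , g≤S = ⊥-elim (<⇒≱ μ<g (≤-trans g≤S (P-bounded _ P≢0 k S |S|≤k)))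

  Ψ Φ : List ℕ → ℕ
  Ψ γ = ∑[ k < suc n ] top k γ
  Φ γ = ∑[ v < suc n ] suffixSum n v (nth γ)

  record MaximalViolator : Set where
    field
      g : List ℕ
      g∈ : g ∈ compositions n d
      violator : Violator g
      Ψ-maximal : ∀ {z} → z ∈ compositions n d → Violator z → Ψ z ≤ Ψ g
      Φ-maximal : ∀ {z} → z ∈ compositions n d → Violator z → Ψ z ≡ Ψ g → Φ z ≤ Φ g

  maximal-violator : ∀ {α} → α ∈ compositions n d → Violator α → MaximalViolator
  maximal-violator α∈ vα with ∃-maximal violator? Ψ α∈ vα
  ... | g₁ , g₁∈ , v₁ , max₁ with ∃-maximal (λ z → violator? z ×-dec (Ψ z ≟ Ψ g₁)) Φ g₁∈ (v₁ , refl)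
  ... | g , g∈ , (vg , Ψg≡Ψg₁) , max₂ = record
    { g = g ; g∈ = g∈ ; violator = vg
    ; Ψ-maximal = λ z∈ vz → ≤-trans (max₁ z∈ vz) (≤-reflexive (sym Ψg≡Ψg₁))
    ; Φ-maximal = λ z∈ vz Ψz≡Ψg → max₂ z∈ (vz , trans Ψz≡Ψg Ψg≡Ψg₁)
    }

  module _ (M : MaximalViolator) where
    open MaximalViolator M

    g-props : IsComposition g × length g ≤ n × sum g ≡ d
    g-props = ∈-compositions⁻ n d g g∈

    only-g-contributes : ∀ {z} → z ∈ compositions n d → C z *ℤ qsSchur n z (padTo g n) ≢ + 0 → z ≡ g
    only-g-contributes {z} z∈ term≢0 = suffixSums-injective n z g ℓz≤n ℓz≡ℓg suffixes-equal
      where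
      z-props : IsComposition z × length z ≤ n × sum z ≡ d
      z-props = ∈-compositions⁻ n d z z∈
      ℓz≤n : length z ≤ n
      ℓz≤n = proj₁ (proj₂ z-props)
      ℓg≤n : length g ≤ n
      ℓg≤n = proj₁ (proj₂ g-props)
      factors : C z ≢ + 0 × qsSchur n z (padTo g n) ≢ + 0
      factors = *ℤ≢0⇒factors (C z) (qsSchur n z (padTo g n)) term≢0
      dominated : ∀ k → top k g ≤ top k z
      dominated = qsSchur-padTo-dominated n g z ℓg≤n (proj₂ factors)
      vz : Violator z
      vz with proj₂ violator
      ... | k , k<K , μ<g = proj₁ factors , k , k<K , <-≤-trans μ<g (dominated k)
      Ψ-equal : Ψ z ≡ Ψ g
      Ψ-equal = ≤-antisym (Ψ-maximal z∈ vz) (∑<-mono-≤ (suc n) (λ k _ → dominated k))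
      tops-equal : ∀ k → k < suc n → top k g ≡ top k z
      tops-equal = ∑<-≤-equal (suc n) (λ k _ → dominated k) (sym Ψ-equal)
      sums-equal : sum z ≡ sum g
      sums-equal = trans (proj₂ (proj₂ z-props)) (sym (proj₂ (proj₂ g-props)))
      ℓz≡ℓg : length z ≡ length g
      ℓz≡ℓg = ≤-antisym
        (equal-tops⇒length≤ n z g (proj₁ z-props) sums-equal ℓg≤n (λ k k≤n → sym (tops-equal k k≤n)))
        (equal-tops⇒length≤ n g z (proj₁ g-props) (sym sums-equal) ℓz≤n tops-equal)
      suffixes-≤ : ∀ v → suffixSum n v (nth g) ≤ suffixSum n v (nth z)
      suffixes-≤ = qsSchur-padTo-suffix n z g (proj₁ z-props) ℓz≡ℓg ℓz≤n (proj₂ factors)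
      Φ-equal : Φ g ≡ Φ z
      Φ-equal = ≤-antisym (∑<-mono-≤ (suc n) (λ v _ → suffixes-≤ v)) (Φ-maximal z∈ vz Ψ-equal)
      suffixes-equal : ∀ v → v < suc n → suffixSum n v (nth z) ≡ suffixSum n v (nth g)
      suffixes-equal v v≤n = sym (∑<-≤-equal (suc n) (λ v _ → suffixes-≤ v) Φ-equal v v≤n)

    no-maximal-violator : ⊥
    no-maximal-violator = sumℤ-single-≢0 term (compositions n d) g g∈ term-g≢0 only-g
      (trans (sym (expansion (padTo g n))) (P-vanishes g ℓg≤n (proj₂ violator)))
      where
      ℓg≤n : length g ≤ n
      ℓg≤n = proj₁ (proj₂ g-props)
      term : List ℕ → ℤ
      term z = C z *ℤ qsSchur n z (padTo g n)
      term-g≢0 : term g ≢ + 0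
      term-g≢0 with qsSchur-padTo-positive n g (proj₁ g-props) ℓg≤n
      ... | q , S≡1+q = *ℤ-≢0 (C g) _ (proj₁ violator) (λ S≡0 → case trans (sym S≡1+q) S≡0 of λ ())
      only-g : ∀ z → z ∈ compositions n d → term z ≡ + 0 ⊎ z ≡ g
      only-g z z∈ with term z ℤP.≟ + 0
      ... | yes t≡0 = inj₁ t≡0
      ... | no t≢0 = inj₂ (only-g-contributes z∈ t≢0)

  coefficient-vanishes : ∀ α → IsComposition α → sum α ≡ d → length α ≤ n →
    ¬ Dominates (sortDec μ) (sortDec α) → C α ≡ + 0
  coefficient-vanishes α posα α≡d ℓα≤n ¬dom with C α ℤP.≟ + 0 | exceeds? α
  ... | yes C≡0 | _ = C≡0
  ... | no _ | no ¬ex = ⊥-elim (¬dom (¬exceeds⇒dominated α ℓα≤n ¬ex))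
  ... | no C≢0 | yes ex = ⊥-elim (no-maximal-violator (maximal-violator α∈ (C≢0 , ex)))
    where α∈ = ∈-compositions⁺ n d α posα α≡d ℓα≤n

theorem5p5 : (n d : ℕ) → 1 ≤ n → (lam β α : List ℕ) →
    IsPartition lam → length lam ≤ n → InB n β → sum lam + sum β ≡ d →
    IsComposition α → sum α ≡ d → length α ≤ n →
    ¬ Dominates (sortDec (phi lam β)) (sortDec α) →
    (C : List ℕ → ℤ) → IsQSExpansion n d (schur n lam ⋆ qsSchur n β) C →
    C α ≡ + 0
theorem5p5 n d _ lam β α lam-partition _ _ _ posα α≡d ℓα≤n ¬dom C expansion =
  Triangularity.coefficient-vanishes n d (schur n lam ⋆ qsSchur n β) (phi lam β)
    (λ e → product-TopBounded n lam β e lam-partition) C expansion α posα α≡d ℓα≤n ¬dom
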